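{- The theory $SA$ is interpretable in $Ar+(\Delta^1_1\text{ - }C)$: there is a translation $\varphi\mapsto\varphi^\wedge$ of formulas of $SA$ into formulas of $Ar$ such that $SA\vdash\varphi$ implies $Ar+(\Delta^1_1\text{ - }C)\vdash\overline{\overline{\varphi}}^\wedge$, where $\overline{\overline{\varphi}}$ is the universal closure of $\varphi$.
   Context: Fix a standard numbering of pairs of natural numbers, $(m,n)$ denoting the number of the pair $m,n$. $SA$: a classical many-sorted second-order arithmetic. Variables: numerical variables $n_1,n_2,\ldots,m,n,\ldots$, and for each $k\geqslant1$ set variables $x_1^{(k)},x_2^{(k)},\ldots$ of sort $k$. Constants $0,1$, function symbols $+,\cdot$, predicate symbols $=$ (for numbers) and $\in_k$ $(k\geqslant1)$. Atomic formulas: $t=\tau$ and $t\in_k x^{(k)}$ for numerical terms $t,\tau$; formulas built with $\bot$, connectives, quantifiers. A formula is $k$-simple if it has no quantifiers over set variables and no variables of sort $>k$. Axioms: classical predicate logic with equality; Peano axioms $\neg(n+1=0)$, $n+1=m+1\supset n=m$, $n+0=n$, $n+(m+1)=(n+m)+1$, $n\cdot0=0$, $n\cdot(m+1)=n\cdot m+n$; induction for every formula; comprehension $\exists z^{(k)}\forall n(n\in z\equiv\varphi(n))$ for $k$-simple $\varphi$ not containing $z^{(k)}$; choice $\forall n\exists!x^{(k)}\varphi(n,x)\supset\exists y^{(k+1)}\forall n\exists x^{(k)}[\varphi(n,x)\wedge\forall m(m\in x\equiv(n,m)\in y)]$ for $k$-simple $\varphi$ (uniqueness with respect to $x=_ky:=\forall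 n(n\in_kx\equiv n\in_ky)$). $Ar$: classical second-order arithmetic with numerical variables and one sort of set variables, constants $0,1$, symbols $+,\cdot,=,\in$; axioms: classical logic with equality, the Peano axioms above, induction for all formulas, and comprehension $\exists z\forall n(n\in z\equiv\varphi(n))$ for $\varphi$ without set quantifiers not containing $z$. $(\Delta^1_1\text{ - }C)$: $\forall n[\forall v\varphi(n,v)\equiv\exists u\psi(n,u)]\supset\exists z\forall n[n\in z\equiv\exists u\psi(n,u)]$, for $\varphi,\psi$ without set quantifiers not containing $z$. -}

module Defs where

open import Data.Nat using (ℕ; zero; suc; _≤_)
open import Data.Fin using (Fin; zero; suc)
open import Data.List using (List; []; _∷_; map)
open import Data.Unit using (⊤; tt)
open import Data.Sum using (_⊎_)

-- Generic syntax of two-sorted arithmetic with set sorts drawn from S.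
-- Numerical variables: de Bruijn indices (Fin n).
-- Set variables: de Bruijn indices into a context Γ : List S of sorts.

data Term (n : ℕ) : Set where
  var : Fin n → Term n
  𝟎 𝟏 : Term n
  _⊕_ _⊗_ : Term n → Term n → Term n

data SVar {S : Set} : List S → S → Set where
  vz : ∀ {Γ k} → SVar (k ∷ Γ) k
  vs : ∀ {Γ k l} → SVar Γ k → SVar (l ∷ Γ) k

infixr 4 _⊃_
infixl 9 _⊕_
infixl 10 _⊗_
infixr 5 _∨'_
infixr 6 _∧'_
infix 7 _≐_ _∈'_

data Form (S : Set) : ℕ → List S → Set where
  ⊥' : ∀ {n Γ} → Form S n Γ
  _≐_ : ∀ {n Γ} → Term n → Term n → Form S n Γ
  _∈'_ : ∀ {n Γ k} → Term n → SVar Γ k → Form S n Γ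
  _∧'_ _∨'_ _⊃_ : ∀ {n Γ} → Form S n Γ → Form S n Γ → Form S n Γ
  ∀N ∃N : ∀ {n Γ} → Form S (suc n) Γ → Form S n Γ
  ∀S ∃S : ∀ {n Γ} (k : S) → Form S n (k ∷ Γ) → Form S n Γ

module _ {S : Set} where

  infix 3 _⇔_

  ¬' : ∀ {n Γ} → Form S n Γ → Form S n Γ
  ¬' φ = φ ⊃ ⊥'

  _⇔_ : ∀ {n Γ} → Form S n Γ → Form S n Γ → Form S n Γ
  φ ⇔ ψ = (φ ⊃ ψ) ∧' (ψ ⊃ φ)

renT : ∀ {n m} → (Fin n → Fin m) → Term n → Term m
renT f (var i) = var (f i)
renT f 𝟎 = 𝟎
renT f 𝟏 = 𝟏
renT f (t ⊕ u) = renT f t ⊕ renT f u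
renT f (t ⊗ u) = renT f t ⊗ renT f u

subT : ∀ {n m} → (Fin n → Term m) → Term n → Term m
subT σ (var i) = σ i
subT σ 𝟎 = 𝟎
subT σ 𝟏 = 𝟏
subT σ (t ⊕ u) = subT σ t ⊕ subT σ u
subT σ (t ⊗ u) = subT σ t ⊗ subT σ u

liftσ : ∀ {n m} → (Fin n → Term m) → Fin (suc n) → Term (suc m)
liftσ σ zero = var zero
liftσ σ (suc i) = renT suc (σ i)

SRen : {S : Set} → List S → List S → Set
SRen Γ Δ = ∀ {k} → SVar Γ k → SVar Δ k

liftρ : ∀ {S : Set} {Γ Δ : List S} {l : S} → SRen Γ Δ → SRen (l ∷ Γ) (l ∷ Δ)
liftρ ρ vz = vz
liftρ ρ (vs x) = vs (ρ x)

sub : ∀ {S n m} {Γ Δ : List S} → (Fin n → Term m) → SRen Γ Δ → Form S n Γ → Form S m Δ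
sub σ ρ ⊥' = ⊥'
sub σ ρ (t ≐ u) = subT σ t ≐ subT σ u
sub σ ρ (t ∈' x) = subT σ t ∈' ρ x
sub σ ρ (φ ∧' ψ) = sub σ ρ φ ∧' sub σ ρ ψ
sub σ ρ (φ ∨' ψ) = sub σ ρ φ ∨' sub σ ρ ψ
sub σ ρ (φ ⊃ ψ) = sub σ ρ φ ⊃ sub σ ρ ψ
sub σ ρ (∀N φ) = ∀N (sub (liftσ σ) ρ φ)
sub σ ρ (∃N φ) = ∃N (sub (liftσ σ) ρ φ)
sub σ ρ (∀S k φ) = ∀S k (sub σ (liftρ ρ) φ)
sub σ ρ (∃S k φ) = ∃S k (sub σ (liftρ ρ) φ)

wkN : ∀ {S n} {Γ : List S} → Form S n Γ → Form S (suc n) Γ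
wkN = sub (λ i → var (suc i)) (λ x → x)

wkS : ∀ {S n} {Γ : List S} {k : S} → Form S n Γ → Form S n (k ∷ Γ)
wkS = sub var vs

consσ : ∀ {n} → Term n → Fin (suc n) → Term n
consσ t zero = t
consσ t (suc i) = var i

inst : ∀ {S n} {Γ : List S} → Term n → Form S (suc n) Γ → Form S n Γ
inst t φ = sub (consσ t) (λ x → x) φ

consρ : ∀ {S : Set} {Γ : List S} {k : S} → SVar Γ k → SRen (k ∷ Γ) Γ
consρ y vz = y
consρ y (vs x) = x

instS : ∀ {S n} {Γ : List S} {k : S} → SVar Γ k → Form S n (k ∷ Γ) → Form S n Γ
instS y φ = sub var (consρ y) φ

skip1 : ∀ {S : Set} {Γ : List S} {k l : S} → SRen (k ∷ Γ) (k ∷ l ∷ Γ)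
skip1 vz = vz
skip1 (vs x) = vs (vs x)

Theory : Set → Set₁
Theory S = ∀ {n} {Γ : List S} → Form S n Γ → Set

infix 2 _⊢_

data _⊢_ {S : Set} (T : Theory S) : ∀ {n} {Γ : List S} → Form S n Γ → Set where
  ax   : ∀ {n Γ} {φ : Form S n Γ} → T φ → T ⊢ φ
  mp   : ∀ {n Γ} {φ ψ : Form S n Γ} → T ⊢ φ ⊃ ψ → T ⊢ φ → T ⊢ ψ
  pK   : ∀ {n Γ} {φ ψ : Form S n Γ} → T ⊢ φ ⊃ ψ ⊃ φ
  pS   : ∀ {n Γ} {φ ψ χ : Form S n Γ} → T ⊢ (φ ⊃ ψ ⊃ χ) ⊃ (φ ⊃ ψ) ⊃ φ ⊃ χ
  ∧i   : ∀ {n Γ} {φ ψ : Form S n Γ} → T ⊢ φ ⊃ ψ ⊃ φ ∧' ψ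
  ∧e₁  : ∀ {n Γ} {φ ψ : Form S n Γ} → T ⊢ φ ∧' ψ ⊃ φ
  ∧e₂  : ∀ {n Γ} {φ ψ : Form S n Γ} → T ⊢ φ ∧' ψ ⊃ ψ
  ∨i₁  : ∀ {n Γ} {φ ψ : Form S n Γ} → T ⊢ φ ⊃ φ ∨' ψ
  ∨i₂  : ∀ {n Γ} {φ ψ : Form S n Γ} → T ⊢ ψ ⊃ φ ∨' ψ
  ∨e   : ∀ {n Γ} {φ ψ χ : Form S n Γ} → T ⊢ (φ ⊃ χ) ⊃ (ψ ⊃ χ) ⊃ φ ∨' ψ ⊃ χ
  ⊥e   : ∀ {n Γ} {φ : Form S n Γ} → T ⊢ ⊥' ⊃ φ
  dne  : ∀ {n Γ} {φ : Form S n Γ} → T ⊢ ¬' (¬' φ) ⊃ φ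
  ∀N-inst : ∀ {n Γ} {φ : Form S (suc n) Γ} (t : Term n) → T ⊢ ∀N φ ⊃ inst t φ
  ∀N-gen  : ∀ {n Γ} {ψ : Form S n Γ} {φ : Form S (suc n) Γ} → T ⊢ wkN ψ ⊃ φ → T ⊢ ψ ⊃ ∀N φ
  ∃N-intro : ∀ {n Γ} {φ : Form S (suc n) Γ} (t : Term n) → T ⊢ inst t φ ⊃ ∃N φ
  ∃N-elim  : ∀ {n Γ} {ψ : Form S n Γ} {φ : Form S (suc n) Γ} → T ⊢ φ ⊃ wkN ψ → T ⊢ ∃N φ ⊃ ψ
  ∀S-inst : ∀ {n Γ k} {φ : Form S n (k ∷ Γ)} (y : SVar Γ k) → T ⊢ ∀S k φ ⊃ instS y φ
  ∀S-gen  : ∀ {n Γ k} {ψ : Form S n Γ} {φ : Form S n (k ∷ Γ)} → T ⊢ wkS ψ ⊃ φ → T ⊢ ψ ⊃ ∀S k φ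
  ∃S-intro : ∀ {n Γ k} {φ : Form S n (k ∷ Γ)} (y : SVar Γ k) → T ⊢ instS y φ ⊃ ∃S k φ
  ∃S-elim  : ∀ {n Γ k} {ψ : Form S n Γ} {φ : Form S n (k ∷ Γ)} → T ⊢ φ ⊃ wkS ψ → T ⊢ ∃S k φ ⊃ ψ
  -- every set sort is nonempty: an unused set variable may be dropped
  S-strengthen : ∀ {n Γ k} {φ : Form S n Γ} → T ⊢ wkS {k = k} φ → T ⊢ φ
  ≐-refl  : ∀ {n Γ} {t : Term n} → T ⊢ _≐_ {Γ = Γ} t t
  ≐-subst : ∀ {n Γ} {t u : Term n} {φ : Form S (suc n) Γ} → T ⊢ t ≐ u ⊃ inst t φ ⊃ inst u φ

data Simple {S : Set} (P : S → Set) : ∀ {n} {Γ : List S} → Form S n Γ → Set where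
  s⊥ : ∀ {n Γ} → Simple P (⊥' {n = n} {Γ = Γ})
  s≐ : ∀ {n Γ} {t u : Term n} → Simple P (_≐_ {Γ = Γ} t u)
  s∈ : ∀ {n Γ k} {t : Term n} {x : SVar Γ k} → P k → Simple P (t ∈' x)
  s∧ : ∀ {n Γ} {φ ψ : Form S n Γ} → Simple P φ → Simple P ψ → Simple P (φ ∧' ψ)
  s∨ : ∀ {n Γ} {φ ψ : Form S n Γ} → Simple P φ → Simple P ψ → Simple P (φ ∨' ψ)
  s⊃ : ∀ {n Γ} {φ ψ : Form S n Γ} → Simple P φ → Simple P ψ → Simple P (φ ⊃ ψ)
  s∀N : ∀ {n Γ} {φ : Form S (suc n) Γ} → Simple P φ → Simple P (∀N φ)
  s∃N : ∀ {n Γ} {φ : Form S (suc n) Γ} → Simple P φ → Simple P (∃N φ)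

v0 v1 : ∀ {n} → Term (suc (suc n))
v0 = var zero
v1 = var (suc zero)

data Basic {S : Set} : Theory S where
  pa1 : ∀ {n Γ} → Basic {n = n} {Γ = Γ} (∀N (¬' (var zero ⊕ 𝟏 ≐ 𝟎)))
  pa2 : ∀ {n Γ} → Basic {n = n} {Γ = Γ} (∀N (∀N (v0 ⊕ 𝟏 ≐ v1 ⊕ 𝟏 ⊃ v0 ≐ v1)))
  pa3 : ∀ {n Γ} → Basic {n = n} {Γ = Γ} (∀N (var zero ⊕ 𝟎 ≐ var zero))
  pa4 : ∀ {n Γ} → Basic {n = n} {Γ = Γ} (∀N (∀N (v1 ⊕ (v0 ⊕ 𝟏) ≐ (v1 ⊕ v0) ⊕ 𝟏)))
  pa5 : ∀ {n Γ} → Basic {n = n} {Γ = Γ} (∀N (var zero ⊗ 𝟎 ≐ 𝟎))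
  pa6 : ∀ {n Γ} → Basic {n = n} {Γ = Γ} (∀N (∀N (v1 ⊗ (v0 ⊕ 𝟏) ≐ (v1 ⊗ v0) ⊕ v1)))
  induction : ∀ {n Γ} (φ : Form S (suc n) Γ) →
    Basic (inst 𝟎 φ ⊃ ∀N (φ ⊃ sub (λ { zero → var zero ⊕ 𝟏 ; (suc i) → var (suc i) }) (λ x → x) φ) ⊃ ∀N φ)

-- The theory SA.  Sort index k : ℕ stands for the paper's sort k+1.

-- "(t,s) ∈ y" for the Cantor numbering (t,s) = ((t+s)(t+s+1))/2 + s,
-- written as ∃p (p+p = (t+s)(t+s+1) + s+s ∧ p ∈ y).
pairMem : ∀ {S n} {Γ : List S} {k : S} → Term n → Term n → SVar Γ k → Form S n Γ
pairMem t s y = ∃N ((var zero ⊕ var zero ≐ ((t' ⊕ s') ⊗ ((t' ⊕ s') ⊕ 𝟏)) ⊕ (s' ⊕ s')) ∧' var zero ∈' y)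
  where
  t' = renT suc t
  s' = renT suc s

eqS : ∀ {S n} {Γ : List S} {k : S} → SVar Γ k → SVar Γ k → Form S n Γ
eqS x y = ∀N (var zero ∈' x ⇔ var zero ∈' y)

data SA-ax : Theory ℕ where
  basic : ∀ {n Γ} {φ : Form ℕ n Γ} → Basic φ → SA-ax φ
  comp : ∀ {n Γ} (k : ℕ) (φ : Form ℕ (suc n) Γ) → Simple (_≤ k) φ →
    SA-ax (∃S k (∀N (var zero ∈' vz ⇔ wkS φ)))
  choice : ∀ {n Γ} (k : ℕ) (φ : Form ℕ (suc n) (k ∷ Γ)) → Simple (_≤ k) φ →
    SA-ax (∀N (∃S k (φ ∧' ∀S k (sub var skip1 φ ⊃ eqS vz (vs vz))))
           ⊃ ∃S (suc k) (∀N (∃S k (sub var skip1 φ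
                 ∧' ∀N (var zero ∈' vz ⇔ pairMem (var (suc zero)) (var zero) (vs vz))))))

SA : Theory ℕ
SA = SA-ax

QF : ∀ {n} {Γ : List ⊤} → Form ⊤ n Γ → Set
QF = Simple (λ _ → ⊤)

data Ar-ax : Theory ⊤ where
  basic : ∀ {n Γ} {φ : Form ⊤ n Γ} → Basic φ → Ar-ax φ
  comp : ∀ {n Γ} (φ : Form ⊤ (suc n) Γ) → QF φ →
    Ar-ax (∃S tt (∀N (var zero ∈' vz ⇔ wkS φ)))

data Δ¹₁-C : Theory ⊤ where
  d11c : ∀ {n Γ} (φ ψ : Form ⊤ (suc n) (tt ∷ Γ)) → QF φ → QF ψ →
    Δ¹₁-C (∀N (∀S tt φ ⇔ ∃S tt ψ)
           ⊃ ∃S tt (∀N (var zero ∈' vz ⇔ ∃S tt (sub var skip1 ψ))))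

ArΔ : Theory ⊤
ArΔ φ = Ar-ax φ ⊎ Δ¹₁-C φ

-- Translations (interpretations) of SA into Ar that keep the arithmetic
-- part fixed: each sort k is given a domain formula D_k(X) and a
-- membership formula M_k(t,X); connectives and numerical quantifiers are
-- preserved, set quantifiers of sort k are relativised to D_k.

record Interp : Set where
  field
    dom : ℕ → Form ⊤ 0 (tt ∷ [])   -- D_k(X), X = set variable 0
    mem : ℕ → Form ⊤ 1 (tt ∷ [])   -- M_k(m,X), m = numerical variable 0

erase : List ℕ → List ⊤
erase = map (λ _ → tt)

trV : ∀ {Γ : List ℕ} {k} → SVar Γ k → SVar (erase Γ) tt
trV vz = vz
trV (vs x) = vs (trV x)

σ1 : ∀ {n} → Term n → Fin 1 → Term n
σ1 t zero = t

σ0 : ∀ {n} → Fin 0 → Term n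
σ0 ()

ρ1 : ∀ {Δ : List ⊤} → SVar Δ tt → SRen (tt ∷ []) Δ
ρ1 y vz = y

tr : Interp → ∀ {n} {Γ : List ℕ} → Form ℕ n Γ → Form ⊤ n (erase Γ)
tr I ⊥' = ⊥'
tr I (t ≐ u) = t ≐ u
tr I (_∈'_ {k = k} t x) = sub (σ1 t) (ρ1 (trV x)) (Interp.mem I k)
tr I (φ ∧' ψ) = tr I φ ∧' tr I ψ
tr I (φ ∨' ψ) = tr I φ ∨' tr I ψ
tr I (φ ⊃ ψ) = tr I φ ⊃ tr I ψ
tr I (∀N φ) = ∀N (tr I φ)
tr I (∃N φ) = ∃N (tr I φ)
tr I (∀S k φ) = ∀S tt (sub σ0 (ρ1 vz) (Interp.dom I k) ⊃ tr I φ)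
tr I (∃S k φ) = ∃S tt (sub σ0 (ρ1 vz) (Interp.dom I k) ∧' tr I φ)

closeN : ∀ {S n} {Γ : List S} → Form S n Γ → Form S 0 Γ
closeN {n = zero} φ = φ
closeN {n = suc n} φ = closeN (∀N φ)

closeS : ∀ {S} {Γ : List S} → Form S 0 Γ → Form S 0 []
closeS {Γ = []} φ = φ
closeS {Γ = k ∷ Γ} φ = closeS (∀S k φ)

closure : ∀ {S n} {Γ : List S} → Form S n Γ → Form S 0 []
closure φ = closeS (closeN φ)

-- Every sort of SA is interpreted as the single sort of sets of Ar, membership as membership.
-- The logical rules, the Peano axioms, induction and comprehension then translate into rules and
-- axioms of Ar.  Only choice needs an argument: from ∀n ∃!X φ(n,X) the set Y = {(n,m) | m ∈ X_n}
-- exists by (Δ¹₁-C), because (n,m) ∈ Y is both ∃X (φ(n,X) ∧ m ∈ X) and ∀X (φ(n,X) ⊃ m ∈ X).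
-- Matching pair codes needs the injectivity of Cantor pairing, which is proved inside Ar by induction.

module Submission where

open import Defs
open import Data.Nat using (ℕ; zero; suc)
open import Data.List using (List; []; _∷_)
open import Data.Product using (Σ; _,_)
open import Data.Fin using (Fin; zero; suc)
open import Data.Unit using (⊤; tt)
open import Data.Sum using (inj₁; inj₂)
open import Relation.Binary.PropositionalEquality

-- Substitution

_≗ᵛ_ : ∀ {S : Set} {Γ Δ : List S} → SRen Γ Δ → SRen Γ Δ → Set
_≗ᵛ_ {S} {Γ} ρ ρ′ = ∀ {k : S} (x : SVar Γ k) → ρ x ≡ ρ′ x

module _ {n m : ℕ} where

  subT-cong : {σ τ : Fin n → Term m} → σ ≗ τ → subT σ ≗ subT τ
  subT-cong e (var i) = e i
  subT-cong e 𝟎 = refl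
  subT-cong e 𝟏 = refl
  subT-cong e (t ⊕ u) = cong₂ _⊕_ (subT-cong e t) (subT-cong e u)
  subT-cong e (t ⊗ u) = cong₂ _⊗_ (subT-cong e t) (subT-cong e u)

  renT≗subT : (f : Fin n → Fin m) → renT f ≗ subT (λ i → var (f i))
  renT≗subT f (var i) = refl
  renT≗subT f 𝟎 = refl
  renT≗subT f 𝟏 = refl
  renT≗subT f (t ⊕ u) = cong₂ _⊕_ (renT≗subT f t) (renT≗subT f u)
  renT≗subT f (t ⊗ u) = cong₂ _⊗_ (renT≗subT f t) (renT≗subT f u)

  liftσ-cong : {σ τ : Fin n → Term m} → σ ≗ τ → liftσ σ ≗ liftσ τ
  liftσ-cong e zero = refl
  liftσ-cong e (suc i) = cong (renT suc) (e i)

subT-subT : ∀ {n m k} (σ : Fin m → Term k) (τ : Fin n → Term m) t →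
  subT σ (subT τ t) ≡ subT (λ i → subT σ (τ i)) t
subT-subT σ τ (var i) = refl
subT-subT σ τ 𝟎 = refl
subT-subT σ τ 𝟏 = refl
subT-subT σ τ (t ⊕ u) = cong₂ _⊕_ (subT-subT σ τ t) (subT-subT σ τ u)
subT-subT σ τ (t ⊗ u) = cong₂ _⊗_ (subT-subT σ τ t) (subT-subT σ τ u)

subT-identity : ∀ {n} (t : Term n) → subT var t ≡ t
subT-identity (var i) = refl
subT-identity 𝟎 = refl
subT-identity 𝟏 = refl
subT-identity (t ⊕ u) = cong₂ _⊕_ (subT-identity t) (subT-identity u)
subT-identity (t ⊗ u) = cong₂ _⊗_ (subT-identity t) (subT-identity u)

subT-liftσ-renT : ∀ {n m} (σ : Fin n → Term m) t → subT (liftσ σ) (renT suc t) ≡ renT suc (subT σ t)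
subT-liftσ-renT σ t = begin
  subT (liftσ σ) (renT suc t)                   ≡⟨ cong (subT (liftσ σ)) (renT≗subT suc t) ⟩
  subT (liftσ σ) (subT (λ i → var (suc i)) t)   ≡⟨ subT-subT (liftσ σ) _ t ⟩
  subT (λ i → renT suc (σ i)) t                 ≡⟨ subT-cong (λ i → renT≗subT suc (σ i)) t ⟩
  subT (λ i → subT (λ j → var (suc j)) (σ i)) t ≡⟨ subT-subT _ σ t ⟨
  subT (λ i → var (suc i)) (subT σ t)           ≡⟨ renT≗subT suc (subT σ t) ⟨
  renT suc (subT σ t)                           ∎
  where open ≡-Reasoning

subT-consσ-renT : ∀ {n} (s t : Term n) → subT (consσ s) (renT suc t) ≡ t
subT-consσ-renT s t = trans (cong (subT (consσ s)) (renT≗subT suc t)) (trans (subT-subT (consσ s) _ t) (subT-identity t))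

liftσ-subT : ∀ {n m k} (σ : Fin m → Term k) (τ : Fin n → Term m) →
  (λ i → subT (liftσ σ) (liftσ τ i)) ≗ liftσ (λ j → subT σ (τ j))
liftσ-subT σ τ zero = refl
liftσ-subT σ τ (suc i) = subT-liftσ-renT σ (τ i)

liftσ-var : ∀ {n} → liftσ {n} var ≗ var
liftσ-var zero = refl
liftσ-var (suc i) = refl

module _ {S : Set} where

  liftρ-cong : ∀ {Γ Δ : List S} {l : S} {ρ ρ′ : SRen Γ Δ} → ρ ≗ᵛ ρ′ → liftρ {l = l} ρ ≗ᵛ liftρ ρ′
  liftρ-cong e vz = refl
  liftρ-cong e (vs x) = cong vs (e x)

  liftρ-∘ : ∀ {Γ Δ Θ : List S} {l : S} (ρ : SRen Δ Θ) (ρ′ : SRen Γ Δ) →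
    (λ x → liftρ {l = l} ρ (liftρ ρ′ x)) ≗ᵛ liftρ (λ x → ρ (ρ′ x))
  liftρ-∘ ρ ρ′ vz = refl
  liftρ-∘ ρ ρ′ (vs x) = refl

  liftρ-id : ∀ {Γ : List S} {l : S} → liftρ {Γ = Γ} {l = l} (λ x → x) ≗ᵛ (λ x → x)
  liftρ-id vz = refl
  liftρ-id (vs x) = refl

  sub-cong : ∀ {n m} {Γ Δ : List S} {σ τ : Fin n → Term m} {ρ ρ′ : SRen Γ Δ} →
    σ ≗ τ → ρ ≗ᵛ ρ′ → (φ : Form S n Γ) → sub σ ρ φ ≡ sub τ ρ′ φ
  sub-cong e r ⊥' = refl
  sub-cong e r (t ≐ u) = cong₂ _≐_ (subT-cong e t) (subT-cong e u)
  sub-cong e r (t ∈' x) = cong₂ _∈'_ (subT-cong e t) (r x)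
  sub-cong e r (φ ∧' ψ) = cong₂ _∧'_ (sub-cong e r φ) (sub-cong e r ψ)
  sub-cong e r (φ ∨' ψ) = cong₂ _∨'_ (sub-cong e r φ) (sub-cong e r ψ)
  sub-cong e r (φ ⊃ ψ) = cong₂ _⊃_ (sub-cong e r φ) (sub-cong e r ψ)
  sub-cong e r (∀N φ) = cong ∀N (sub-cong (liftσ-cong e) r φ)
  sub-cong e r (∃N φ) = cong ∃N (sub-cong (liftσ-cong e) r φ)
  sub-cong e r (∀S k φ) = cong (∀S k) (sub-cong e (liftρ-cong r) φ)
  sub-cong e r (∃S k φ) = cong (∃S k) (sub-cong e (liftρ-cong r) φ)

  sub-sub : ∀ {n m k} {Γ Δ Θ : List S} (σ : Fin m → Term k) (ρ : SRen Δ Θ) (τ : Fin n → Term m) (ρ′ : SRen Γ Δ)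
    (φ : Form S n Γ) → sub σ ρ (sub τ ρ′ φ) ≡ sub (λ i → subT σ (τ i)) (λ x → ρ (ρ′ x)) φ
  sub-sub σ ρ τ ρ′ ⊥' = refl
  sub-sub σ ρ τ ρ′ (t ≐ u) = cong₂ _≐_ (subT-subT σ τ t) (subT-subT σ τ u)
  sub-sub σ ρ τ ρ′ (t ∈' x) = cong (_∈' _) (subT-subT σ τ t)
  sub-sub σ ρ τ ρ′ (φ ∧' ψ) = cong₂ _∧'_ (sub-sub σ ρ τ ρ′ φ) (sub-sub σ ρ τ ρ′ ψ)
  sub-sub σ ρ τ ρ′ (φ ∨' ψ) = cong₂ _∨'_ (sub-sub σ ρ τ ρ′ φ) (sub-sub σ ρ τ ρ′ ψ)
  sub-sub σ ρ τ ρ′ (φ ⊃ ψ) = cong₂ _⊃_ (sub-sub σ ρ τ ρ′ φ) (sub-sub σ ρ τ ρ′ ψ)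
  sub-sub σ ρ τ ρ′ (∀N φ) = cong ∀N (trans (sub-sub (liftσ σ) ρ (liftσ τ) ρ′ φ) (sub-cong (liftσ-subT σ τ) (λ _ → refl) φ))
  sub-sub σ ρ τ ρ′ (∃N φ) = cong ∃N (trans (sub-sub (liftσ σ) ρ (liftσ τ) ρ′ φ) (sub-cong (liftσ-subT σ τ) (λ _ → refl) φ))
  sub-sub σ ρ τ ρ′ (∀S k φ) = cong (∀S k) (trans (sub-sub σ (liftρ ρ) τ (liftρ ρ′) φ) (sub-cong (λ _ → refl) (liftρ-∘ ρ ρ′) φ))
  sub-sub σ ρ τ ρ′ (∃S k φ) = cong (∃S k) (trans (sub-sub σ (liftρ ρ) τ (liftρ ρ′) φ) (sub-cong (λ _ → refl) (liftρ-∘ ρ ρ′) φ))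

  sub-identity : ∀ {n} {Γ : List S} (φ : Form S n Γ) → sub var (λ x → x) φ ≡ φ
  sub-identity ⊥' = refl
  sub-identity (t ≐ u) = cong₂ _≐_ (subT-identity t) (subT-identity u)
  sub-identity (t ∈' x) = cong (_∈' x) (subT-identity t)
  sub-identity (φ ∧' ψ) = cong₂ _∧'_ (sub-identity φ) (sub-identity ψ)
  sub-identity (φ ∨' ψ) = cong₂ _∨'_ (sub-identity φ) (sub-identity ψ)
  sub-identity (φ ⊃ ψ) = cong₂ _⊃_ (sub-identity φ) (sub-identity ψ)
  sub-identity (∀N φ) = cong ∀N (trans (sub-cong liftσ-var (λ _ → refl) φ) (sub-identity φ))
  sub-identity (∃N φ) = cong ∃N (trans (sub-cong liftσ-var (λ _ → refl) φ) (sub-identity φ))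
  sub-identity (∀S k φ) = cong (∀S k) (trans (sub-cong (λ _ → refl) liftρ-id φ) (sub-identity φ))
  sub-identity (∃S k φ) = cong (∃S k) (trans (sub-cong (λ _ → refl) liftρ-id φ) (sub-identity φ))

  instS-vz-liftρ-vs : ∀ {n} {Γ : List S} {k : S} (φ : Form S n (k ∷ Γ)) →
    instS vz (sub var (liftρ (vs {l = k})) φ) ≡ φ
  instS-vz-liftρ-vs φ =
    trans (sub-sub var (consρ vz) var (liftρ vs) φ) (trans (sub-cong (λ _ → refl) (λ { vz → refl ; (vs x) → refl }) φ) (sub-identity φ))

  -- Instance search flattens a tower  sub σ₁ ρ₁ (… (sub σₖ ρₖ φ))  into a single substitution instance of φ.
  record SubInstance {n m} {Γ Δ : List S} (φ : Form S n Γ) (A : Form S m Δ) : Set where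
    field
      σ : Fin n → Term m
      ρ : SRen Γ Δ
      flattens : A ≡ sub σ ρ φ

  instance
    sub-instance-refl : ∀ {n} {Γ : List S} {φ : Form S n Γ} → SubInstance φ φ
    sub-instance-refl {φ = φ} = record { σ = var ; ρ = λ x → x ; flattens = sym (sub-identity φ) }

    sub-instance-sub : ∀ {n m k} {Γ Δ Θ : List S} {σ : Fin m → Term k} {ρ : SRen Δ Θ} {φ : Form S n Γ} {A : Form S m Δ} →
      {{SubInstance φ A}} → SubInstance φ (sub σ ρ A)
    sub-instance-sub {σ = σ} {ρ} {φ} {{i}} = record
      { σ = λ j → subT σ (SubInstance.σ i j)
      ; ρ = λ x → ρ (SubInstance.ρ i x)
      ; flattens = trans (cong (sub σ ρ) (SubInstance.flattens i)) (sub-sub σ ρ _ _ φ) }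

⊤' : ∀ {S : Set} {n Γ} → Form S n Γ
⊤' = ⊥' ⊃ ⊥'

Simple-sub : ∀ {S : Set} {P : S → Set} {n m} {Γ Δ : List S} {σ : Fin n → Term m} {ρ : SRen Γ Δ} {φ : Form S n Γ} →
  Simple P φ → Simple P (sub σ ρ φ)
Simple-sub s⊥ = s⊥
Simple-sub s≐ = s≐
Simple-sub (s∈ p) = s∈ p
Simple-sub (s∧ p q) = s∧ (Simple-sub p) (Simple-sub q)
Simple-sub (s∨ p q) = s∨ (Simple-sub p) (Simple-sub q)
Simple-sub (s⊃ p q) = s⊃ (Simple-sub p) (Simple-sub q)
Simple-sub (s∀N p) = s∀N (Simple-sub p)
Simple-sub (s∃N p) = s∃N (Simple-sub p)

-- Natural deduction

module Deduction {S : Set} (T : Theory S) where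

  infixl 4 _▷_
  data Ctx (n : ℕ) (Γ : List S) : Set where
    ε : Ctx n Γ
    _▷_ : Ctx n Γ → Form S n Γ → Ctx n Γ

  mapC : ∀ {n m Γ Δ} → (Form S n Γ → Form S m Δ) → Ctx n Γ → Ctx m Δ
  mapC f ε = ε
  mapC f (H ▷ a) = mapC f H ▷ f a

  infixr 3 _⟹_
  _⟹_ : ∀ {n Γ} → Ctx n Γ → Form S n Γ → Form S n Γ
  ε ⟹ φ = φ
  (H ▷ a) ⟹ φ = H ⟹ (a ⊃ φ)

  infix 2 _⊩_
  record _⊩_ {n Γ} (H : Ctx n Γ) (φ : Form S n Γ) : Set where
    constructor ⟨_⟩
    field un : T ⊢ H ⟹ φ
  open _⊩_ public

  ⊃-refl : ∀ {n Γ} {φ : Form S n Γ} → T ⊢ φ ⊃ φ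
  ⊃-refl {φ = φ} = mp (mp pS pK) (pK {ψ = φ})

  private
    weaken⟹ : ∀ {n Γ} (H : Ctx n Γ) {φ} → T ⊢ φ → T ⊢ H ⟹ φ
    weaken⟹ ε p = p
    weaken⟹ (H ▷ a) p = weaken⟹ H (mp pK p)

    mp⟹ : ∀ {n Γ} (H : Ctx n Γ) {a b} → T ⊢ H ⟹ (a ⊃ b) → T ⊢ H ⟹ a → T ⊢ H ⟹ b
    mp⟹ ε p q = mp p q
    mp⟹ (H ▷ c) p q = mp⟹ H (mp⟹ H (weaken⟹ H pS) p) q

  lift : ∀ {n Γ} {H : Ctx n Γ} {φ} → T ⊢ φ → H ⊩ φ
  lift {H = H} p = ⟨ weaken⟹ H p ⟩

  ⊃E : ∀ {n Γ} {H : Ctx n Γ} {a b} → H ⊩ a ⊃ b → H ⊩ a → H ⊩ b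
  ⊃E {H = H} ⟨ p ⟩ ⟨ q ⟩ = ⟨ mp⟹ H p q ⟩

  ⊃I : ∀ {n Γ} {H : Ctx n Γ} {a b} → H ▷ a ⊩ b → H ⊩ a ⊃ b
  ⊃I ⟨ p ⟩ = ⟨ p ⟩

  hyp : ∀ {n Γ} {H : Ctx n Γ} {a} → H ▷ a ⊩ a
  hyp {H = H} = ⟨ weaken⟹ H ⊃-refl ⟩

  weaken : ∀ {n Γ} {H : Ctx n Γ} {a φ} → H ⊩ φ → H ▷ a ⊩ φ
  weaken p = ⟨ un (⊃E (lift pK) p) ⟩

  hyp1 : ∀ {n Γ} {H : Ctx n Γ} {a b} → H ▷ a ▷ b ⊩ a
  hyp1 = weaken hyp
  hyp2 : ∀ {n Γ} {H : Ctx n Γ} {a b c} → H ▷ a ▷ b ▷ c ⊩ a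
  hyp2 = weaken hyp1
  hyp3 : ∀ {n Γ} {H : Ctx n Γ} {a b c d} → H ▷ a ▷ b ▷ c ▷ d ⊩ a
  hyp3 = weaken hyp2
  hyp4 : ∀ {n Γ} {H : Ctx n Γ} {a b c d e} → H ▷ a ▷ b ▷ c ▷ d ▷ e ⊩ a
  hyp4 = weaken hyp3
  hyp5 : ∀ {n Γ} {H : Ctx n Γ} {a b c d e f} → H ▷ a ▷ b ▷ c ▷ d ▷ e ▷ f ⊩ a
  hyp5 = weaken hyp4
  hyp6 : ∀ {n Γ} {H : Ctx n Γ} {a b c d e f g} → H ▷ a ▷ b ▷ c ▷ d ▷ e ▷ f ▷ g ⊩ a
  hyp6 = weaken hyp5
  hyp7 : ∀ {n Γ} {H : Ctx n Γ} {a b c d e f g h} → H ▷ a ▷ b ▷ c ▷ d ▷ e ▷ f ▷ g ▷ h ⊩ a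
  hyp7 = weaken hyp6
  hyp8 : ∀ {n Γ} {H : Ctx n Γ} {a b c d e f g h i} → H ▷ a ▷ b ▷ c ▷ d ▷ e ▷ f ▷ g ▷ h ▷ i ⊩ a
  hyp8 = weaken hyp7

  cut : ∀ {n Γ} {H : Ctx n Γ} {a b} → H ⊩ a → H ▷ a ⊩ b → H ⊩ b
  cut p q = ⊃E (⊃I q) p

  ⊤I : ∀ {n Γ} {H : Ctx n Γ} → H ⊩ ⊤'
  ⊤I = lift ⊃-refl

  ⊥E : ∀ {n Γ} {H : Ctx n Γ} {a} → H ⊩ ⊥' → H ⊩ a
  ⊥E p = ⊃E (lift ⊥e) p

  ∧I : ∀ {n Γ} {H : Ctx n Γ} {a b} → H ⊩ a → H ⊩ b → H ⊩ a ∧' b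
  ∧I p q = ⊃E (⊃E (lift ∧i) p) q

  ∧E₁ : ∀ {n Γ} {H : Ctx n Γ} {a b} → H ⊩ a ∧' b → H ⊩ a
  ∧E₁ p = ⊃E (lift ∧e₁) p

  ∧E₂ : ∀ {n Γ} {H : Ctx n Γ} {a b} → H ⊩ a ∧' b → H ⊩ b
  ∧E₂ p = ⊃E (lift ∧e₂) p

  ∨I₁ : ∀ {n Γ} {H : Ctx n Γ} {a b} → H ⊩ a → H ⊩ a ∨' b
  ∨I₁ p = ⊃E (lift ∨i₁) p

  ∨I₂ : ∀ {n Γ} {H : Ctx n Γ} {a b} → H ⊩ b → H ⊩ a ∨' b
  ∨I₂ p = ⊃E (lift ∨i₂) p

  ∨E : ∀ {n Γ} {H : Ctx n Γ} {a b c} → H ⊩ a ∨' b → H ▷ a ⊩ c → H ▷ b ⊩ c → H ⊩ c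
  ∨E p q r = ⊃E (⊃E (⊃E (lift ∨e) (⊃I q)) (⊃I r)) p

  ⇔I : ∀ {n Γ} {H : Ctx n Γ} {a b} → H ▷ a ⊩ b → H ▷ b ⊩ a → H ⊩ (a ⇔ b)
  ⇔I p q = ∧I (⊃I p) (⊃I q)

  ⇔E₁ : ∀ {n Γ} {H : Ctx n Γ} {a b} → H ⊩ (a ⇔ b) → H ⊩ a → H ⊩ b
  ⇔E₁ p q = ⊃E (∧E₁ p) q

  ⇔E₂ : ∀ {n Γ} {H : Ctx n Γ} {a b} → H ⊩ (a ⇔ b) → H ⊩ b → H ⊩ a
  ⇔E₂ p q = ⊃E (∧E₂ p) q

  -- Quantifier rules go through the conjunction of the context, to which the Hilbert rules apply.
  private
    ⋀ : ∀ {n Γ} → Ctx n Γ → Form S n Γ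
    ⋀ ε = ⊤'
    ⋀ (H ▷ a) = ⋀ H ∧' a

    ⊩⋀ : ∀ {n Γ} (H : Ctx n Γ) → H ⊩ ⋀ H
    ⊩⋀ ε = ⊤I
    ⊩⋀ (H ▷ a) = ∧I (weaken (⊩⋀ H)) hyp

    from⋀ : ∀ {n Γ} (H : Ctx n Γ) {φ} → T ⊢ ⋀ H ⊃ φ → H ⊩ φ
    from⋀ H p = ⊃E (lift p) (⊩⋀ H)

    to⋀ : ∀ {n Γ} (H : Ctx n Γ) {φ} → H ⊩ φ → T ⊢ ⋀ H ⊃ φ
    to⋀ ε ⟨ p ⟩ = mp pK p
    to⋀ (H ▷ a) p = un {H = ε} (⊃I (⊃E (⊃E (lift (to⋀ H (⊃I p))) (∧E₁ hyp)) (∧E₂ hyp)))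

    ⋀-wkN : ∀ {n Γ} (H : Ctx n Γ) → ⋀ (mapC wkN H) ≡ wkN (⋀ H)
    ⋀-wkN ε = refl
    ⋀-wkN (H ▷ a) = cong (_∧' wkN a) (⋀-wkN H)

    ⋀-wkS : ∀ {n Γ k} (H : Ctx n Γ) → ⋀ (mapC (wkS {k = k}) H) ≡ wkS (⋀ H)
    ⋀-wkS ε = refl
    ⋀-wkS (H ▷ a) = cong (_∧' wkS a) (⋀-wkS H)

    to⋀-wkN : ∀ {n Γ} (H : Ctx n Γ) {φ} → mapC wkN H ⊩ φ → T ⊢ wkN (⋀ H) ⊃ φ
    to⋀-wkN H p = subst (λ z → T ⊢ z ⊃ _) (⋀-wkN H) (to⋀ (mapC wkN H) p)

    to⋀-wkS : ∀ {n Γ k} (H : Ctx n Γ) {φ} → mapC (wkS {k = k}) H ⊩ φ → T ⊢ wkS (⋀ H) ⊃ φ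
    to⋀-wkS H p = subst (λ z → T ⊢ z ⊃ _) (⋀-wkS H) (to⋀ (mapC wkS H) p)

  ∀I : ∀ {n Γ} {H : Ctx n Γ} {φ} → mapC wkN H ⊩ φ → H ⊩ ∀N φ
  ∀I {H = H} p = from⋀ H (∀N-gen (to⋀-wkN H p))

  ∀E : ∀ {n Γ} {H : Ctx n Γ} {φ} → H ⊩ ∀N φ → (t : Term n) → H ⊩ inst t φ
  ∀E p t = ⊃E (lift (∀N-inst t)) p

  ∃I : ∀ {n Γ} {H : Ctx n Γ} {φ} (t : Term n) → H ⊩ inst t φ → H ⊩ ∃N φ
  ∃I t p = ⊃E (lift (∃N-intro t)) p

  ∃E : ∀ {n Γ} {H : Ctx n Γ} {φ χ} → H ⊩ ∃N φ → mapC wkN H ▷ φ ⊩ wkN χ → H ⊩ χ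
  ∃E {H = H} p q = ⊃E (⊃E (lift (∃N-elim (un {H = ε} swapped))) p) (⊩⋀ H)
    where
    swapped = ⊃I (⊃I (⊃E (⊃E (lift (to⋀-wkN H (⊃I q))) hyp) hyp1))

  ∀SI : ∀ {n Γ k} {H : Ctx n Γ} {φ} → mapC (wkS {k = k}) H ⊩ φ → H ⊩ ∀S k φ
  ∀SI {H = H} p = from⋀ H (∀S-gen (to⋀-wkS H p))

  ∀SE : ∀ {n Γ k} {H : Ctx n Γ} {φ} → H ⊩ ∀S k φ → (y : SVar Γ k) → H ⊩ instS y φ
  ∀SE p y = ⊃E (lift (∀S-inst y)) p

  ∃SI : ∀ {n Γ k} {H : Ctx n Γ} {φ} (y : SVar Γ k) → H ⊩ instS y φ → H ⊩ ∃S k φ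
  ∃SI y p = ⊃E (lift (∃S-intro y)) p

  ∃SE : ∀ {n Γ k} {H : Ctx n Γ} {φ χ} → H ⊩ ∃S k φ → mapC (wkS {k = k}) H ▷ φ ⊩ wkS χ → H ⊩ χ
  ∃SE {H = H} p q = ⊃E (⊃E (lift (∃S-elim (un {H = ε} swapped))) p) (⊩⋀ H)
    where
    swapped = ⊃I (⊃I (⊃E (⊃E (lift (to⋀-wkS H (⊃I q))) hyp) hyp1))

  ∃S-map : ∀ {n Γ k} {H : Ctx n Γ} {A B : Form S n (k ∷ Γ)} → H ⊩ ∃S k A → mapC wkS H ▷ A ⊩ B → H ⊩ ∃S k B
  ∃S-map {H = H} {A} {B} p q = ∃SE p (∃SI vz (subst (mapC wkS H ▷ A ⊩_) (sym (instS-vz-liftρ-vs B)) q))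

  ≐I : ∀ {n Γ} {H : Ctx n Γ} {t} → H ⊩ t ≐ t
  ≐I = lift ≐-refl

  ≐E : ∀ {n Γ} {H : Ctx n Γ} {t u} (φ : Form S (suc n) Γ) → H ⊩ t ≐ u → H ⊩ inst t φ → H ⊩ inst u φ
  ≐E φ p q = ⊃E (⊃E (lift ≐-subst) p) q

  reindex : ∀ {n m Γ Δ} {H : Ctx m Δ} {φ : Form S n Γ} {A B : Form S m Δ}
    {{a : SubInstance φ A}} {{b : SubInstance φ B}} →
    SubInstance.σ a ≗ SubInstance.σ b → SubInstance.ρ a ≗ᵛ SubInstance.ρ b → H ⊩ A → H ⊩ B
  reindex {H = H} {φ} {{a}} {{b}} eσ eρ =
    subst (H ⊩_) (trans (SubInstance.flattens a) (trans (sub-cong eσ eρ φ) (sym (SubInstance.flattens b))))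

  infixr 1 _∙_
  _∙_ : ∀ {n Γ} {H : Ctx n Γ} {t u v} → H ⊩ t ≐ u → H ⊩ u ≐ v → H ⊩ t ≐ v
  _∙_ {H = H} {t} {u} {v} p q =
    subst (λ z → H ⊩ z ≐ v) (subT-consσ-renT v t)
      (≐E (renT suc t ≐ var zero) q (subst (λ z → H ⊩ z ≐ u) (sym (subT-consσ-renT u t)) p))

  ≐-cong : ∀ {n Γ} {H : Ctx n Γ} {t u} (C : Term (suc n)) → H ⊩ t ≐ u → H ⊩ subT (consσ t) C ≐ subT (consσ u) C
  ≐-cong {H = H} {t} {u} C p =
    subst (λ z → H ⊩ z ≐ subT (consσ u) C) (subT-consσ-renT u (subT (consσ t) C))
      (≐E (renT suc (subT (consσ t) C) ≐ C) p
        (subst (λ z → H ⊩ z ≐ subT (consσ t) C) (sym (subT-consσ-renT t (subT (consσ t) C))) ≐I))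

  ≐-sym : ∀ {n Γ} {H : Ctx n Γ} {t u} → H ⊩ t ≐ u → H ⊩ u ≐ t
  ≐-sym {H = H} {t} {u} p =
    subst (λ z → H ⊩ u ≐ z) (subT-consσ-renT u t)
      (≐E (var zero ≐ renT suc t) p (subst (λ z → H ⊩ t ≐ z) (sym (subT-consσ-renT t t)) ≐I))

  ⊕-congʳ : ∀ {n Γ} {H : Ctx n Γ} {t u} b → H ⊩ t ≐ u → H ⊩ t ⊕ b ≐ u ⊕ b
  ⊕-congʳ {H = H} {t} {u} b p =
    subst₂ (λ z w → H ⊩ t ⊕ z ≐ u ⊕ w) (subT-consσ-renT t b) (subT-consσ-renT u b) (≐-cong (var zero ⊕ renT suc b) p)

  ⊕-congˡ : ∀ {n Γ} {H : Ctx n Γ} {t u} b → H ⊩ t ≐ u → H ⊩ b ⊕ t ≐ b ⊕ u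
  ⊕-congˡ {H = H} {t} {u} b p =
    subst₂ (λ z w → H ⊩ z ⊕ t ≐ w ⊕ u) (subT-consσ-renT t b) (subT-consσ-renT u b) (≐-cong (renT suc b ⊕ var zero) p)

  ⊗-congʳ : ∀ {n Γ} {H : Ctx n Γ} {t u} b → H ⊩ t ≐ u → H ⊩ t ⊗ b ≐ u ⊗ b
  ⊗-congʳ {H = H} {t} {u} b p =
    subst₂ (λ z w → H ⊩ t ⊗ z ≐ u ⊗ w) (subT-consσ-renT t b) (subT-consσ-renT u b) (≐-cong (var zero ⊗ renT suc b) p)

  ⊗-congˡ : ∀ {n Γ} {H : Ctx n Γ} {t u} b → H ⊩ t ≐ u → H ⊩ b ⊗ t ≐ b ⊗ u
  ⊗-congˡ {H = H} {t} {u} b p =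
    subst₂ (λ z w → H ⊩ z ⊗ t ≐ w ⊗ u) (subT-consσ-renT t b) (subT-consσ-renT u b) (≐-cong (renT suc b ⊗ var zero) p)

  ⊕-cong : ∀ {n Γ} {H : Ctx n Γ} {a b c d} → H ⊩ a ≐ b → H ⊩ c ≐ d → H ⊩ a ⊕ c ≐ b ⊕ d
  ⊕-cong {b = b} {c = c} p q = ⊕-congʳ c p ∙ ⊕-congˡ b q

  ⊗-cong : ∀ {n Γ} {H : Ctx n Γ} {a b c d} → H ⊩ a ≐ b → H ⊩ c ≐ d → H ⊩ a ⊗ c ≐ b ⊗ d
  ⊗-cong {b = b} {c = c} p q = ⊗-congʳ c p ∙ ⊗-congˡ b q

  closed : ∀ {n Γ} {H : Ctx n Γ} {φ} → ε ⊩ φ → H ⊩ φ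
  closed p = lift (un p)

-- Arithmetic

module Arithmetic {S : Set} (T : Theory S) (basic⊆T : ∀ {n Γ} {φ : Form S n Γ} → Basic φ → T φ) where
  open Deduction T

  #0 : ∀ {n} → Term (suc n)
  #0 = var zero
  #1 : ∀ {n} → Term (suc (suc n))
  #1 = var (suc zero)
  #2 : ∀ {n} → Term (suc (suc (suc n)))
  #2 = var (suc (suc zero))
  #3 : ∀ {n} → Term (suc (suc (suc (suc n))))
  #3 = var (suc (suc (suc zero)))
  #4 : ∀ {n} → Term (suc (suc (suc (suc (suc n)))))
  #4 = var (suc (suc (suc (suc zero))))
  #5 : ∀ {n} → Term (suc (suc (suc (suc (suc (suc n))))))
  #5 = var (suc (suc (suc (suc (suc zero)))))

  Scheme₁ : (∀ {m} {Δ : List S} → Term m → Form S m Δ) → Set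
  Scheme₁ F = ∀ {m m′ Δ Δ′} (σ : Fin m → Term m′) (ρ : SRen Δ Δ′) a → sub σ ρ (F a) ≡ F (subT σ a)

  Scheme₂ : (∀ {m} {Δ : List S} → Term m → Term m → Form S m Δ) → Set
  Scheme₂ F = ∀ {m m′ Δ Δ′} (σ : Fin m → Term m′) (ρ : SRen Δ Δ′) a b → sub σ ρ (F a b) ≡ F (subT σ a) (subT σ b)

  Scheme₃ : (∀ {m} {Δ : List S} → Term m → Term m → Term m → Form S m Δ) → Set
  Scheme₃ F = ∀ {m m′ Δ Δ′} (σ : Fin m → Term m′) (ρ : SRen Δ Δ′) a b c →
    sub σ ρ (F a b c) ≡ F (subT σ a) (subT σ b) (subT σ c)

  instantiate₁ : (F : ∀ {m} {Δ : List S} → Term m → Form S m Δ) → Scheme₁ F →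
    ∀ {n Γ} {H : Ctx n Γ} → H ⊩ ∀N (F #0) → ∀ a → H ⊩ F a
  instantiate₁ F F-sub {H = H} p a = subst (H ⊩_) (F-sub (consσ a) (λ x → x) #0) (∀E p a)

  instantiate₂ : (F : ∀ {m} {Δ : List S} → Term m → Term m → Form S m Δ) → Scheme₂ F →
    ∀ {n Γ} {H : Ctx n Γ} → H ⊩ ∀N (∀N (F #1 #0)) → ∀ a b → H ⊩ F a b
  instantiate₂ F F-sub {H = H} p a b =
    subst (λ z → H ⊩ F z b) (subT-consσ-renT b a)
      (subst (H ⊩_) (F-sub (consσ b) (λ x → x) (renT suc a) #0)
        (∀E (subst (λ z → H ⊩ ∀N z) (F-sub (liftσ (consσ a)) (λ x → x) #1 #0) (∀E p a)) b))

  instantiate₃ : (F : ∀ {m} {Δ : List S} → Term m → Term m → Term m → Form S m Δ) → Scheme₃ F →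
    ∀ {n Γ} {H : Ctx n Γ} → H ⊩ ∀N (∀N (∀N (F #2 #1 #0))) → ∀ a b c → H ⊩ F a b c
  instantiate₃ F F-sub {H = H} p a b c =
    subst₂ (λ z w → H ⊩ F z w c) (subT-consσ-renT c a) (subT-consσ-renT c b)
      (subst (H ⊩_) (F-sub (consσ c) (λ x → x) (renT suc a) (renT suc b) #0)
        (∀E (subst (λ z → H ⊩ ∀N (F z (renT suc b) #0)) a↑↑
          (subst (λ z → H ⊩ ∀N z) (F-sub (liftσ (consσ b)) (λ x → x) (renT suc (renT suc a)) #1 #0)
            (∀E (subst (λ z → H ⊩ ∀N (∀N z)) (F-sub (liftσ (liftσ (consσ a))) (λ x → x) #2 #1 #0)
              (∀E p a)) b))) c))
    where
    a↑↑ : subT (liftσ (consσ b)) (renT suc (renT suc a)) ≡ renT suc a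
    a↑↑ = trans (subT-liftσ-renT (consσ b) (renT suc a)) (cong (renT suc) (subT-consσ-renT b a))

  +𝟏≢𝟎 : ∀ {n Γ} {H : Ctx n Γ} a → H ⊩ a ⊕ 𝟏 ≐ 𝟎 → H ⊩ ⊥'
  +𝟏≢𝟎 a = ⊃E (instantiate₁ (λ x → (x ⊕ 𝟏 ≐ 𝟎) ⊃ ⊥') (λ _ _ _ → refl) (lift (ax (basic⊆T pa1))) a)

  +𝟏-injective : ∀ {n Γ} {H : Ctx n Γ} a b → H ⊩ a ⊕ 𝟏 ≐ b ⊕ 𝟏 → H ⊩ a ≐ b
  +𝟏-injective a b = ⊃E (instantiate₂ (λ x y → (y ⊕ 𝟏 ≐ x ⊕ 𝟏) ⊃ y ≐ x) (λ _ _ _ _ → refl) (lift (ax (basic⊆T pa2))) b a)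

  ⊕-identityʳ : ∀ {n Γ} {H : Ctx n Γ} a → H ⊩ a ⊕ 𝟎 ≐ a
  ⊕-identityʳ = instantiate₁ (λ x → x ⊕ 𝟎 ≐ x) (λ _ _ _ → refl) (lift (ax (basic⊆T pa3)))

  ⊕-suc : ∀ {n Γ} {H : Ctx n Γ} a b → H ⊩ a ⊕ (b ⊕ 𝟏) ≐ (a ⊕ b) ⊕ 𝟏
  ⊕-suc = instantiate₂ (λ x y → x ⊕ (y ⊕ 𝟏) ≐ (x ⊕ y) ⊕ 𝟏) (λ _ _ _ _ → refl) (lift (ax (basic⊆T pa4)))

  ⊗-zeroʳ : ∀ {n Γ} {H : Ctx n Γ} a → H ⊩ a ⊗ 𝟎 ≐ 𝟎
  ⊗-zeroʳ = instantiate₁ (λ x → x ⊗ 𝟎 ≐ 𝟎) (λ _ _ _ → refl) (lift (ax (basic⊆T pa5)))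

  ⊗-suc : ∀ {n Γ} {H : Ctx n Γ} a b → H ⊩ a ⊗ (b ⊕ 𝟏) ≐ (a ⊗ b) ⊕ a
  ⊗-suc = instantiate₂ (λ x y → x ⊗ (y ⊕ 𝟏) ≐ (x ⊗ y) ⊕ x) (λ _ _ _ _ → refl) (lift (ax (basic⊆T pa6)))

  successor : ∀ {n} → Fin (suc n) → Term (suc n)
  successor zero = #0 ⊕ 𝟏
  successor (suc i) = var (suc i)

  induction-rule : ∀ {n Γ} {H : Ctx n Γ} (φ : Form S (suc n) Γ) →
    H ⊩ inst 𝟎 φ → mapC wkN H ▷ φ ⊩ sub successor (λ x → x) φ → H ⊩ ∀N φ
  induction-rule φ base step = ⊃E (⊃E (lift axiom) base) (∀I (⊃I step))
    where
    axiom = subst (λ ψ → T ⊢ inst 𝟎 φ ⊃ ∀N (φ ⊃ ψ) ⊃ ∀N φ)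
      (sub-cong (λ { zero → refl ; (suc i) → refl }) (λ _ → refl) φ) (ax (basic⊆T (induction φ)))

  ⊕-identityˡ : ∀ {n Γ} {H : Ctx n Γ} a → H ⊩ 𝟎 ⊕ a ≐ a
  ⊕-identityˡ = instantiate₁ (λ x → 𝟎 ⊕ x ≐ x) (λ _ _ _ → refl) (closed ∀-form)
    where
    ∀-form : ∀ {n Γ} → ε {n} {Γ} ⊩ ∀N (𝟎 ⊕ #0 ≐ #0)
    ∀-form = induction-rule (𝟎 ⊕ #0 ≐ #0) (⊕-identityʳ 𝟎) (⊕-suc 𝟎 #0 ∙ ⊕-congʳ 𝟏 hyp)

  ⊕-assoc : ∀ {n Γ} {H : Ctx n Γ} a b c → H ⊩ (a ⊕ b) ⊕ c ≐ a ⊕ (b ⊕ c)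
  ⊕-assoc = instantiate₃ (λ x y z → (x ⊕ y) ⊕ z ≐ x ⊕ (y ⊕ z)) (λ _ _ _ _ _ → refl) (closed ∀-form)
    where
    ∀-form : ∀ {n Γ} → ε {n} {Γ} ⊩ ∀N (∀N (∀N ((#2 ⊕ #1) ⊕ #0 ≐ #2 ⊕ (#1 ⊕ #0))))
    ∀-form = ∀I (∀I (induction-rule ((#2 ⊕ #1) ⊕ #0 ≐ #2 ⊕ (#1 ⊕ #0))
      (⊕-identityʳ (#1 ⊕ #0) ∙ ≐-sym (⊕-congˡ #1 (⊕-identityʳ #0)))
      (⊕-suc (#2 ⊕ #1) #0 ∙ ⊕-congʳ 𝟏 hyp ∙ ≐-sym (⊕-suc #2 (#1 ⊕ #0)) ∙ ⊕-congˡ #2 (≐-sym (⊕-suc #1 #0)))))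

  𝟏⊕-comm : ∀ {n Γ} {H : Ctx n Γ} a → H ⊩ 𝟏 ⊕ a ≐ a ⊕ 𝟏
  𝟏⊕-comm = instantiate₁ (λ x → 𝟏 ⊕ x ≐ x ⊕ 𝟏) (λ _ _ _ → refl) (closed ∀-form)
    where
    ∀-form : ∀ {n Γ} → ε {n} {Γ} ⊩ ∀N (𝟏 ⊕ #0 ≐ #0 ⊕ 𝟏)
    ∀-form = induction-rule (𝟏 ⊕ #0 ≐ #0 ⊕ 𝟏) (⊕-identityʳ 𝟏 ∙ ≐-sym (⊕-identityˡ 𝟏)) (⊕-suc 𝟏 #0 ∙ ⊕-congʳ 𝟏 hyp)

  ⊕-comm : ∀ {n Γ} {H : Ctx n Γ} a b → H ⊩ a ⊕ b ≐ b ⊕ a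
  ⊕-comm = instantiate₂ (λ x y → x ⊕ y ≐ y ⊕ x) (λ _ _ _ _ → refl) (closed ∀-form)
    where
    ∀-form : ∀ {n Γ} → ε {n} {Γ} ⊩ ∀N (∀N (#1 ⊕ #0 ≐ #0 ⊕ #1))
    ∀-form = ∀I (induction-rule (#1 ⊕ #0 ≐ #0 ⊕ #1) (⊕-identityʳ #0 ∙ ≐-sym (⊕-identityˡ #0))
      (⊕-suc #1 #0 ∙ ⊕-congʳ 𝟏 hyp ∙ ≐-sym (⊕-suc #0 #1) ∙ ⊕-congˡ #0 (≐-sym (𝟏⊕-comm #1)) ∙ ≐-sym (⊕-assoc #0 𝟏 #1)))

  ⊕-interchange : ∀ {n Γ} {H : Ctx n Γ} a b c d → H ⊩ (a ⊕ b) ⊕ (c ⊕ d) ≐ (a ⊕ c) ⊕ (b ⊕ d)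
  ⊕-interchange a b c d =
    ⊕-assoc a b (c ⊕ d) ∙ ⊕-congˡ a (≐-sym (⊕-assoc b c d) ∙ ⊕-congʳ d (⊕-comm b c) ∙ ⊕-assoc c b d) ∙ ≐-sym (⊕-assoc a c (b ⊕ d))

  ⊗-zeroˡ : ∀ {n Γ} {H : Ctx n Γ} a → H ⊩ 𝟎 ⊗ a ≐ 𝟎
  ⊗-zeroˡ = instantiate₁ (λ x → 𝟎 ⊗ x ≐ 𝟎) (λ _ _ _ → refl) (closed ∀-form)
    where
    ∀-form : ∀ {n Γ} → ε {n} {Γ} ⊩ ∀N (𝟎 ⊗ #0 ≐ 𝟎)
    ∀-form = induction-rule (𝟎 ⊗ #0 ≐ 𝟎) (⊗-zeroʳ 𝟎) (⊗-suc 𝟎 #0 ∙ ⊕-identityʳ (𝟎 ⊗ #0) ∙ hyp)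

  ⊗-distribʳ-⊕ : ∀ {n Γ} {H : Ctx n Γ} a b c → H ⊩ (a ⊕ b) ⊗ c ≐ (a ⊗ c) ⊕ (b ⊗ c)
  ⊗-distribʳ-⊕ = instantiate₃ (λ x y z → (x ⊕ y) ⊗ z ≐ (x ⊗ z) ⊕ (y ⊗ z)) (λ _ _ _ _ _ → refl) (closed ∀-form)
    where
    ∀-form : ∀ {n Γ} → ε {n} {Γ} ⊩ ∀N (∀N (∀N ((#2 ⊕ #1) ⊗ #0 ≐ (#2 ⊗ #0) ⊕ (#1 ⊗ #0))))
    ∀-form = ∀I (∀I (induction-rule ((#2 ⊕ #1) ⊗ #0 ≐ (#2 ⊗ #0) ⊕ (#1 ⊗ #0))
      (⊗-zeroʳ _ ∙ ≐-sym (⊕-cong (⊗-zeroʳ #1) (⊗-zeroʳ #0) ∙ ⊕-identityʳ 𝟎))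
      (⊗-suc (#2 ⊕ #1) #0 ∙ ⊕-congʳ (#2 ⊕ #1) hyp ∙ ⊕-interchange _ _ _ _ ∙ ≐-sym (⊕-cong (⊗-suc #2 #0) (⊗-suc #1 #0)))))

  ⊗-identityˡ : ∀ {n Γ} {H : Ctx n Γ} a → H ⊩ 𝟏 ⊗ a ≐ a
  ⊗-identityˡ = instantiate₁ (λ x → 𝟏 ⊗ x ≐ x) (λ _ _ _ → refl) (closed ∀-form)
    where
    ∀-form : ∀ {n Γ} → ε {n} {Γ} ⊩ ∀N (𝟏 ⊗ #0 ≐ #0)
    ∀-form = induction-rule (𝟏 ⊗ #0 ≐ #0) (⊗-zeroʳ 𝟏) (⊗-suc 𝟏 #0 ∙ ⊕-congʳ 𝟏 hyp)

  ⊗-comm : ∀ {n Γ} {H : Ctx n Γ} a b → H ⊩ a ⊗ b ≐ b ⊗ a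
  ⊗-comm = instantiate₂ (λ x y → x ⊗ y ≐ y ⊗ x) (λ _ _ _ _ → refl) (closed ∀-form)
    where
    ∀-form : ∀ {n Γ} → ε {n} {Γ} ⊩ ∀N (∀N (#1 ⊗ #0 ≐ #0 ⊗ #1))
    ∀-form = ∀I (induction-rule (#1 ⊗ #0 ≐ #0 ⊗ #1) (⊗-zeroʳ #0 ∙ ≐-sym (⊗-zeroˡ #0))
      (⊗-suc #1 #0 ∙ ⊕-cong hyp (≐-sym (⊗-identityˡ #1)) ∙ ≐-sym (⊗-distribʳ-⊕ #0 𝟏 #1)))

  ⊗-assoc : ∀ {n Γ} {H : Ctx n Γ} a b c → H ⊩ (a ⊗ b) ⊗ c ≐ a ⊗ (b ⊗ c)
  ⊗-assoc = instantiate₃ (λ x y z → (x ⊗ y) ⊗ z ≐ x ⊗ (y ⊗ z)) (λ _ _ _ _ _ → refl) (closed ∀-form)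
    where
    ∀-form : ∀ {n Γ} → ε {n} {Γ} ⊩ ∀N (∀N (∀N ((#2 ⊗ #1) ⊗ #0 ≐ #2 ⊗ (#1 ⊗ #0))))
    ∀-form = ∀I (∀I (induction-rule ((#2 ⊗ #1) ⊗ #0 ≐ #2 ⊗ (#1 ⊗ #0))
      (⊗-zeroʳ _ ∙ ≐-sym (⊗-congˡ #1 (⊗-zeroʳ #0) ∙ ⊗-zeroʳ #1))
      (⊗-suc (#2 ⊗ #1) #0 ∙ ⊕-congʳ (#2 ⊗ #1) hyp ∙ ⊕-cong (⊗-comm #2 (#1 ⊗ #0)) (⊗-comm #2 #1)
        ∙ ≐-sym (⊗-distribʳ-⊕ (#1 ⊗ #0) #1 #2) ∙ ⊗-comm _ #2 ∙ ⊗-congˡ #2 (≐-sym (⊗-suc #1 #0)))))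

  -- Provable equality in a fixed context makes terms a commutative semiring, so the ring solver applies.
  module TermSemiring {n Γ} (H : Ctx n Γ) where
    open import Relation.Binary.Structures using (IsEquivalence)
    open import Algebra.Structures.Biased (λ a b → H ⊩ a ≐ b) using (IsCommutativeMonoidˡ; IsCommutativeSemiringˡ)
    open import Algebra.Bundles using (CommutativeSemiring)

    ≐-isEquivalence : IsEquivalence (λ a b → H ⊩ a ≐ b)
    ≐-isEquivalence = record { refl = ≐I ; sym = ≐-sym ; trans = _∙_ }

    ⊕-isCommutativeMonoid : IsCommutativeMonoidˡ _⊕_ 𝟎
    ⊕-isCommutativeMonoid = record
      { isSemigroup = record { isMagma = record { isEquivalence = ≐-isEquivalence ; ∙-cong = ⊕-cong } ; assoc = ⊕-assoc }
      ; identityˡ = ⊕-identityˡ ; comm = ⊕-comm }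

    ⊗-isCommutativeMonoid : IsCommutativeMonoidˡ _⊗_ 𝟏
    ⊗-isCommutativeMonoid = record
      { isSemigroup = record { isMagma = record { isEquivalence = ≐-isEquivalence ; ∙-cong = ⊗-cong } ; assoc = ⊗-assoc }
      ; identityˡ = ⊗-identityˡ ; comm = ⊗-comm }

    commutativeSemiring : CommutativeSemiring _ _
    commutativeSemiring = record
      { Carrier = Term n ; _≈_ = λ a b → H ⊩ a ≐ b ; _+_ = _⊕_ ; _*_ = _⊗_ ; 0# = 𝟎 ; 1# = 𝟏
      ; isCommutativeSemiring = IsCommutativeSemiringˡ.isCommutativeSemiring (record
          { +-isCommutativeMonoid = IsCommutativeMonoidˡ.isCommutativeMonoid ⊕-isCommutativeMonoid
          ; *-isCommutativeMonoid = IsCommutativeMonoidˡ.isCommutativeMonoid ⊗-isCommutativeMonoid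
          ; distribʳ = λ x y z → ⊗-distribʳ-⊕ y z x
          ; zeroˡ = ⊗-zeroˡ }) }

    open import Algebra.Solver.Ring.NaturalCoefficients.Default commutativeSemiring public

  ⊕-cancelʳ : ∀ {n Γ} {H : Ctx n Γ} a b c → H ⊩ a ⊕ c ≐ b ⊕ c → H ⊩ a ≐ b
  ⊕-cancelʳ a b c = ⊃E (instantiate₃ (λ z x y → (x ⊕ z ≐ y ⊕ z) ⊃ x ≐ y) (λ _ _ _ _ _ → refl) (closed ∀-form) c a b)
    where
    ∀-form : ∀ {n Γ} → ε {n} {Γ} ⊩ ∀N (∀N (∀N ((#1 ⊕ #2 ≐ #0 ⊕ #2) ⊃ #1 ≐ #0)))
    ∀-form = induction-rule (∀N (∀N ((#1 ⊕ #2 ≐ #0 ⊕ #2) ⊃ #1 ≐ #0)))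
      (∀I (∀I (⊃I (≐-sym (⊕-identityʳ #1) ∙ hyp ∙ ⊕-identityʳ #0))))
      (∀I (∀I (⊃I (⊃E (∀E (∀E hyp1 #1) #0) (+𝟏-injective (#1 ⊕ #2) (#0 ⊕ #2) (≐-sym (⊕-suc #1 #2) ∙ hyp ∙ ⊕-suc #0 #2))))))

  x≢x⊕y⊕𝟏 : ∀ {n Γ} {H : Ctx n Γ} a b → H ⊩ a ≐ (a ⊕ b) ⊕ 𝟏 → H ⊩ ⊥'
  x≢x⊕y⊕𝟏 {H = H} a b p = +𝟏≢𝟎 b (≐-sym (⊕-cancelʳ 𝟎 (b ⊕ 𝟏) a (⊕-identityˡ a ∙ p ∙ rearrange)))
    where
    open TermSemiring H
    rearrange : H ⊩ (a ⊕ b) ⊕ 𝟏 ≐ (b ⊕ 𝟏) ⊕ a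
    rearrange = solve 2 (λ x y → (x :+ y) :+ con 1 := (y :+ con 1) :+ x) ≐I a b

  zero-or-suc : ∀ {n Γ} → ε {n} {Γ} ⊩ ∀N (#0 ≐ 𝟎 ∨' ∃N (#1 ≐ #0 ⊕ 𝟏))
  zero-or-suc = induction-rule (#0 ≐ 𝟎 ∨' ∃N (#1 ≐ #0 ⊕ 𝟏)) (∨I₁ ≐I) (∨I₂ (∃I #0 ≐I))

  ≤-or-> : ∀ {n Γ} → ε {n} {Γ} ⊩ ∀N (∀N (∃N (#1 ≐ #2 ⊕ #0) ∨' ∃N (#2 ≐ (#1 ⊕ #0) ⊕ 𝟏)))
  ≤-or-> = induction-rule (∀N (∃N (#1 ≐ #2 ⊕ #0) ∨' ∃N (#2 ≐ (#1 ⊕ #0) ⊕ 𝟏)))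
    (∀I (∨I₁ (∃I #0 (≐-sym (⊕-identityˡ #0)))))
    (∀I (∨E (∀E hyp #0)
      (∃E hyp (∨E (∀E (closed zero-or-suc) #0)
        (∨I₂ (∃I 𝟎 (⊕-congʳ 𝟏 (≐-sym (⊕-identityʳ #1 ∙ hyp1 ∙ ⊕-congˡ #2 hyp ∙ ⊕-identityʳ #2)))))
        (∃E hyp (∨I₁ (∃I #0 (hyp2 ∙ ⊕-congˡ #3 hyp ∙ ⊕-congˡ #3 (⊕-comm #0 𝟏) ∙ ≐-sym (⊕-assoc #3 𝟏 #0)))))))
      (∃E hyp (∨I₂ (∃I (#0 ⊕ 𝟏) (⊕-congʳ 𝟏 (hyp ∙ ≐-sym (⊕-suc #1 #0))))))))

  pronic : ∀ {n} → Term n → Term n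
  pronic s = s ⊗ (s ⊕ 𝟏)

  -- Twice the Cantor code (a,b) = (a+b)(a+b+1)/2 + b, in the form used by  pairMem.
  twicePair : ∀ {n} → Term n → Term n → Term n
  twicePair a b = pronic (a ⊕ b) ⊕ (b ⊕ b)

  pronic-cong : ∀ {n Γ} {H : Ctx n Γ} {s t} → H ⊩ s ≐ t → H ⊩ pronic s ≐ pronic t
  pronic-cong p = ⊗-cong p (⊕-congʳ 𝟏 p)

  pronic-even : ∀ {n Γ} → ε {n} {Γ} ⊩ ∀N (∃N (#0 ⊕ #0 ≐ pronic #1))
  pronic-even = induction-rule (∃N (#0 ⊕ #0 ≐ pronic #1))
    (∃I 𝟎 (⊕-identityʳ 𝟎 ∙ ≐-sym (⊗-zeroˡ _)))
    (∃E hyp (∃I (#0 ⊕ (#1 ⊕ 𝟏)) (regroup #0 #1 ∙ ⊕-congʳ _ hyp ∙ pronic-suc #1)))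
    where
    regroup : ∀ {n Γ} {H : Ctx n Γ} q s → H ⊩ (q ⊕ (s ⊕ 𝟏)) ⊕ (q ⊕ (s ⊕ 𝟏)) ≐ (q ⊕ q) ⊕ ((s ⊕ 𝟏) ⊕ (s ⊕ 𝟏))
    regroup {H = H} = solve 2 (λ q s → (q :+ (s :+ con 1)) :+ (q :+ (s :+ con 1)) := (q :+ q) :+ ((s :+ con 1) :+ (s :+ con 1))) ≐I
      where open TermSemiring H
    pronic-suc : ∀ {n Γ} {H : Ctx n Γ} s → H ⊩ pronic s ⊕ ((s ⊕ 𝟏) ⊕ (s ⊕ 𝟏)) ≐ pronic (s ⊕ 𝟏)
    pronic-suc {H = H} = solve 1 (λ s → (s :* (s :+ con 1)) :+ ((s :+ con 1) :+ (s :+ con 1)) := (s :+ con 1) :* ((s :+ con 1) :+ con 1)) ≐I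
      where open TermSemiring H

  twicePair-even : ∀ {n Γ} → ε {n} {Γ} ⊩ ∀N (∀N (∃N (#0 ⊕ #0 ≐ twicePair #2 #1)))
  twicePair-even = ∀I (∀I (∃E (∀E (closed pronic-even) (#1 ⊕ #0)) (∃I (#0 ⊕ #1) (regroup #0 #1 ∙ ⊕-congʳ (#1 ⊕ #1) hyp))))
    where
    regroup : ∀ {n Γ} {H : Ctx n Γ} q b → H ⊩ (q ⊕ b) ⊕ (q ⊕ b) ≐ (q ⊕ q) ⊕ (b ⊕ b)
    regroup {H = H} = solve 2 (λ q b → (q :+ b) :+ (q :+ b) := (q :+ q) :+ (b :+ b)) ≐I
      where open TermSemiring H

  -- Codes of pairs with larger coordinate sum are strictly larger: (s+e+1)(s+e+2) ≥ s(s+1) + 2s + 2 > s(s+1) + 2b.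
  twicePair-grows : ∀ {n Γ} {H : Ctx n Γ} a b e a′ b′ →
    H ⊩ a′ ⊕ b′ ≐ (a ⊕ b) ⊕ (e ⊕ 𝟏) → H ⊩ twicePair a b ≐ twicePair a′ b′ → H ⊩ ⊥'
  twicePair-grows {H = H} a b e a′ b′ sums codes =
    x≢x⊕y⊕𝟏 (twicePair a b) _ (codes ∙ ⊕-congʳ (b′ ⊕ b′) (pronic-cong sums) ∙ expand)
    where
    open TermSemiring H
    s = a ⊕ b
    expand : H ⊩ pronic (s ⊕ (e ⊕ 𝟏)) ⊕ (b′ ⊕ b′)
               ≐ (twicePair a b ⊕ (((((s ⊗ e) ⊕ (s ⊗ e)) ⊕ (a ⊕ a)) ⊕ ((e ⊗ e) ⊕ ((e ⊕ e) ⊕ e))) ⊕ (𝟏 ⊕ (b′ ⊕ b′)))) ⊕ 𝟏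
    expand = solve 4 (λ a b e b′ →
        (((a :+ b) :+ (e :+ con 1)) :* (((a :+ b) :+ (e :+ con 1)) :+ con 1)) :+ (b′ :+ b′)
        := ((((a :+ b) :* ((a :+ b) :+ con 1)) :+ (b :+ b))
             :+ ((((((a :+ b) :* e) :+ ((a :+ b) :* e)) :+ (a :+ a)) :+ ((e :* e) :+ ((e :+ e) :+ e))) :+ (con 1 :+ (b′ :+ b′))))
           :+ con 1) ≐I a b e b′

  twicePair-excess-zero : ∀ {n Γ} →
    ε {n} {Γ} ⊩ ∀N (∀N (∀N (∀N (∀N ((#2 ⊕ #1 ≐ (#4 ⊕ #3) ⊕ #0) ⊃ (twicePair #4 #3 ≐ twicePair #2 #1) ⊃ #0 ≐ 𝟎)))))
  twicePair-excess-zero = ∀I (∀I (∀I (∀I (∀I (⊃I (⊃I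
    (∨E (∀E (closed zero-or-suc) #0) hyp
      (∃E hyp (⊥E (twicePair-grows #5 #4 #0 #3 #2 (hyp3 ∙ ⊕-congˡ _ hyp) hyp2))))))))))

  double-injective : ∀ {n Γ} {H : Ctx n Γ} a b → H ⊩ a ⊕ a ≐ b ⊕ b → H ⊩ a ≐ b
  double-injective a b = ⊃E (instantiate₂ (λ x y → (x ⊕ x ≐ y ⊕ y) ⊃ x ≐ y) (λ _ _ _ _ → refl) (closed ∀-form) a b)
    where
    double-⊕-suc : ∀ {n Γ} {H : Ctx n Γ} b e → H ⊩ (b ⊕ (e ⊕ 𝟏)) ⊕ (b ⊕ (e ⊕ 𝟏)) ≐ ((b ⊕ b) ⊕ ((e ⊕ e) ⊕ 𝟏)) ⊕ 𝟏
    double-⊕-suc {H = H} = solve 2 (λ b e → (b :+ (e :+ con 1)) :+ (b :+ (e :+ con 1)) := ((b :+ b) :+ ((e :+ e) :+ con 1)) :+ con 1) ≐I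
      where open TermSemiring H
    double-suc-⊕ : ∀ {n Γ} {H : Ctx n Γ} b d → H ⊩ ((b ⊕ d) ⊕ 𝟏) ⊕ ((b ⊕ d) ⊕ 𝟏) ≐ ((b ⊕ b) ⊕ ((d ⊕ d) ⊕ 𝟏)) ⊕ 𝟏
    double-suc-⊕ {H = H} = solve 2 (λ b d → ((b :+ d) :+ con 1) :+ ((b :+ d) :+ con 1) := ((b :+ b) :+ ((d :+ d) :+ con 1)) :+ con 1) ≐I
      where open TermSemiring H
    ∀-form : ∀ {n Γ} → ε {n} {Γ} ⊩ ∀N (∀N ((#1 ⊕ #1 ≐ #0 ⊕ #0) ⊃ #1 ≐ #0))
    ∀-form = ∀I (∀I (⊃I (∨E (∀E (∀E (closed ≤-or->) #1) #0)
      (∃E hyp (∨E (∀E (closed zero-or-suc) #0)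
        (≐-sym (hyp1 ∙ ⊕-congˡ #2 hyp ∙ ⊕-identityʳ #2))
        (∃E hyp (⊥E (x≢x⊕y⊕𝟏 (#3 ⊕ #3) _ (hyp4 ∙ ⊕-cong (hyp2 ∙ ⊕-congˡ #3 hyp) (hyp2 ∙ ⊕-congˡ #3 hyp) ∙ double-⊕-suc #3 #0))))))
      (∃E hyp (⊥E (x≢x⊕y⊕𝟏 (#1 ⊕ #1) _ (≐-sym hyp2 ∙ ⊕-cong hyp hyp ∙ double-suc-⊕ #1 #0)))))))

  twicePair-snd : ∀ {n Γ} {H : Ctx n Γ} a b a′ b′ →
    H ⊩ a′ ⊕ b′ ≐ a ⊕ b → H ⊩ twicePair a b ≐ twicePair a′ b′ → H ⊩ b ≐ b′
  twicePair-snd a b a′ b′ sums codes = double-injective b b′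
    (⊕-cancelʳ (b ⊕ b) (b′ ⊕ b′) (pronic (a ⊕ b)) (⊕-comm _ _ ∙ codes ∙ ⊕-congʳ (b′ ⊕ b′) (pronic-cong sums) ∙ ⊕-comm _ _))

  twicePair-injective : ∀ {n Γ} → ε {n} {Γ} ⊩ ∀N (∀N (∀N (∀N ((twicePair #3 #2 ≐ twicePair #1 #0) ⊃ (#3 ≐ #1) ∧' (#2 ≐ #0)))))
  twicePair-injective = ∀I (∀I (∀I (∀I (⊃I
    (∨E (∀E (∀E (closed ≤-or->) (#3 ⊕ #2)) (#1 ⊕ #0))
      (∃E hyp
        (cut (⊃E (⊃E (∀E (∀E (∀E (∀E (∀E (closed twicePair-excess-zero) #4) #3) #2) #1) #0) hyp) hyp2)
        (cut (hyp1 ∙ ⊕-congˡ _ hyp ∙ ⊕-identityʳ _)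
        (cut (twicePair-snd #4 #3 #2 #1 hyp hyp4)
          (∧I (⊕-cancelʳ #4 #2 #3 (≐-sym hyp1 ∙ ⊕-congˡ #2 (≐-sym hyp))) hyp)))))
      (∃E hyp (⊥E (+𝟏≢𝟎 #0 (⊃E (⊃E (∀E (∀E (∀E (∀E (∀E (closed twicePair-excess-zero) #2) #1) #4) #3) (#0 ⊕ 𝟏))
        (hyp ∙ ≐-sym (⊕-suc _ #0))) (≐-sym hyp2))))))))))

-- Translation

module _ (I : Interp) where

  private
    dom-closed : ∀ {n m} {Γ Δ : List ⊤} (σ : Fin n → Term m) (ρ′ : SRen Γ Δ) k →
      sub σ (liftρ ρ′) (sub σ0 (ρ1 vz) (Interp.dom I k)) ≡ sub σ0 (ρ1 vz) (Interp.dom I k)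
    dom-closed σ ρ′ k = trans (sub-sub σ (liftρ ρ′) σ0 (ρ1 vz) (Interp.dom I k)) (sub-cong (λ ()) (λ { vz → refl }) (Interp.dom I k))

    lift-h : ∀ {Γ Δ : List ℕ} {l} {ρ : SRen Γ Δ} {ρ′ : SRen (erase Γ) (erase Δ)} →
      (∀ {k} (x : SVar Γ k) → ρ′ (trV x) ≡ trV (ρ x)) →
      ∀ {k} (x : SVar (l ∷ Γ) k) → liftρ ρ′ (trV x) ≡ trV (liftρ ρ x)
    lift-h h vz = refl
    lift-h h (vs x) = cong vs (h x)

  tr-sub : ∀ {n m} {Γ Δ : List ℕ} (σ : Fin n → Term m) (ρ : SRen Γ Δ) (ρ′ : SRen (erase Γ) (erase Δ)) →
    (∀ {k} (x : SVar Γ k) → ρ′ (trV x) ≡ trV (ρ x)) → (φ : Form ℕ n Γ) → tr I (sub σ ρ φ) ≡ sub σ ρ′ (tr I φ)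
  tr-sub σ ρ ρ′ h ⊥' = refl
  tr-sub σ ρ ρ′ h (t ≐ u) = refl
  tr-sub σ ρ ρ′ h (_∈'_ {k = k} t x) = sym (trans (sub-sub σ ρ′ (σ1 t) (ρ1 (trV x)) (Interp.mem I k))
    (sub-cong (λ { zero → refl }) (λ { vz → h x }) (Interp.mem I k)))
  tr-sub σ ρ ρ′ h (φ ∧' ψ) = cong₂ _∧'_ (tr-sub σ ρ ρ′ h φ) (tr-sub σ ρ ρ′ h ψ)
  tr-sub σ ρ ρ′ h (φ ∨' ψ) = cong₂ _∨'_ (tr-sub σ ρ ρ′ h φ) (tr-sub σ ρ ρ′ h ψ)
  tr-sub σ ρ ρ′ h (φ ⊃ ψ) = cong₂ _⊃_ (tr-sub σ ρ ρ′ h φ) (tr-sub σ ρ ρ′ h ψ)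
  tr-sub σ ρ ρ′ h (∀N φ) = cong ∀N (tr-sub (liftσ σ) ρ ρ′ h φ)
  tr-sub σ ρ ρ′ h (∃N φ) = cong ∃N (tr-sub (liftσ σ) ρ ρ′ h φ)
  tr-sub σ ρ ρ′ h (∀S k φ) = cong₂ (λ d ψ → ∀S tt (d ⊃ ψ)) (sym (dom-closed σ ρ′ k)) (tr-sub σ (liftρ ρ) (liftρ ρ′) (lift-h h) φ)
  tr-sub σ ρ ρ′ h (∃S k φ) = cong₂ (λ d ψ → ∃S tt (d ∧' ψ)) (sym (dom-closed σ ρ′ k)) (tr-sub σ (liftρ ρ) (liftρ ρ′) (lift-h h) φ)

  tr-wkN : ∀ {n} {Γ : List ℕ} (φ : Form ℕ n Γ) → tr I (wkN φ) ≡ wkN (tr I φ)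
  tr-wkN = tr-sub _ (λ x → x) (λ x → x) (λ _ → refl)

  tr-wkS : ∀ {n} {Γ : List ℕ} {k} (φ : Form ℕ n Γ) → tr I (wkS {k = k} φ) ≡ wkS (tr I φ)
  tr-wkS = tr-sub var vs vs (λ _ → refl)

  tr-inst : ∀ {n} {Γ : List ℕ} (t : Term n) (φ : Form ℕ (suc n) Γ) → tr I (inst t φ) ≡ inst t (tr I φ)
  tr-inst t = tr-sub (consσ t) (λ x → x) (λ x → x) (λ _ → refl)

  tr-instS : ∀ {n} {Γ : List ℕ} {k} (y : SVar Γ k) (φ : Form ℕ n (k ∷ Γ)) → tr I (instS y φ) ≡ instS (trV y) (tr I φ)
  tr-instS y = tr-sub var (consρ y) (consρ (trV y)) (λ { vz → refl ; (vs x) → refl })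

  tr-skip1 : ∀ {n} {Γ : List ℕ} {k l} (φ : Form ℕ n (k ∷ Γ)) → tr I (sub var (skip1 {l = l}) φ) ≡ sub var skip1 (tr I φ)
  tr-skip1 = tr-sub var skip1 skip1 (λ { vz → refl ; (vs x) → refl })

  tr-Simple : ∀ {P : ℕ → Set} {n} {Γ : List ℕ} {φ : Form ℕ n Γ} → (∀ k → QF (Interp.mem I k)) → Simple P φ → QF (tr I φ)
  tr-Simple mem-QF s⊥ = s⊥
  tr-Simple mem-QF s≐ = s≐
  tr-Simple mem-QF (s∈ {k = k} _) = Simple-sub (mem-QF k)
  tr-Simple mem-QF (s∧ p q) = s∧ (tr-Simple mem-QF p) (tr-Simple mem-QF q)
  tr-Simple mem-QF (s∨ p q) = s∨ (tr-Simple mem-QF p) (tr-Simple mem-QF q)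
  tr-Simple mem-QF (s⊃ p q) = s⊃ (tr-Simple mem-QF p) (tr-Simple mem-QF q)
  tr-Simple mem-QF (s∀N p) = s∀N (tr-Simple mem-QF p)
  tr-Simple mem-QF (s∃N p) = s∃N (tr-Simple mem-QF p)

collapse : Interp
collapse = record { dom = λ _ → ⊤' ; mem = λ _ → var zero ∈' vz }

-- Choice

open Deduction ArΔ
open Arithmetic ArΔ (λ b → inj₁ (basic b))

module Choice {n} {G : List ⊤} (Φ : Form ⊤ (suc n) (tt ∷ G)) (Φ-QF : QF Φ) where

  Φ-reindex : ∀ {m Δ} {H : Ctx m Δ} {A B : Form ⊤ m Δ} {{a : SubInstance Φ A}} {{b : SubInstance Φ B}} →
    SubInstance.σ a zero ≡ SubInstance.σ b zero → SubInstance.ρ a vz ≡ SubInstance.ρ b vz →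
    (λ i → SubInstance.σ a (suc i)) ≡ (λ i → SubInstance.σ b (suc i)) →
    (λ (x : SVar G tt) → SubInstance.ρ a (vs x)) ≡ (λ x → SubInstance.ρ b (vs x)) → H ⊩ A → H ⊩ B
  Φ-reindex {{a}} {{b}} σ₀ ρ₀ σ₊ ρ₊ =
    reindex {{a}} {{b}} (λ { zero → σ₀ ; (suc i) → cong-app σ₊ i }) (λ { vz → ρ₀ ; (vs x) → cong-app ρ₊ x })

  unique-choice : Form ⊤ n G
  unique-choice = ∀N (∃S tt (⊤' ∧' (Φ ∧' ∀S tt (⊤' ⊃ (sub var skip1 Φ ⊃ eqS vz (vs vz))))))

  choice-function : Form ⊤ n G
  choice-function = ∃S tt (⊤' ∧' ∀N (∃S tt (⊤' ∧' (sub var skip1 Φ ∧' ∀N (#0 ∈' vz ⇔ pairMem #1 #0 (vs vz))))))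

  codes : Form ⊤ (suc (suc (suc n))) (tt ∷ G)
  codes = #2 ⊕ #2 ≐ twicePair #1 #0

  Φ-at : Form ⊤ (suc (suc (suc n))) (tt ∷ G)
  Φ-at = sub (λ { zero → #1 ; (suc i) → var (suc (suc (suc i))) }) (λ x → x) Φ

  in-graph∃ in-graph∀ : Form ⊤ (suc n) (tt ∷ G)
  in-graph∃ = ∃N (∃N (codes ∧' (Φ-at ∧' #0 ∈' vz)))
  in-graph∀ = ∃N (∃N codes) ∧' ∀N (∀N (codes ⊃ Φ-at ⊃ #0 ∈' vz))

  -- Some set is needed to learn from ∀V that p codes a pair (a,b); then take V = X_a.
  graph∀⇒graph∃ : ε ▷ wkN unique-choice ▷ ∀S tt in-graph∀ ⊩ ∃S tt in-graph∃
  graph∀⇒graph∃ = ∃SE (∀E hyp1 𝟎) (∃E (∧E₁ (∀SE hyp1 vz)) (∃E hyp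
    (∃SE (∀E hyp4 #1) (∃SI vz (∃I #1 (∃I #0 (∧I hyp1 (∧I
      (Φ-reindex refl refl refl refl (∧E₁ (∧E₂ hyp)))
      (⊃E (⊃E (∀E (∀E (∧E₂ (∀SE hyp4 vz)) #1) #0) hyp1)
        (Φ-reindex refl refl refl refl (∧E₁ (∧E₂ hyp))))))))))))

  -- If p codes (a,b) and (a′,b′) then a = a′, b = b′, and uniqueness of X_a identifies V with U.
  graph∃⇒graph∀ : ε ▷ wkN unique-choice ▷ ∃S tt in-graph∃ ⊩ ∀S tt in-graph∀
  graph∃⇒graph∀ = ∃SE hyp (∃E hyp (∃E hyp (∀SI (∧I (∃I #1 (∃I #0 (∧E₁ hyp))) (∀I (∀I (⊃I (⊃I
    (cut (⊃E (∀E (∀E (∀E (∀E (closed twicePair-injective) #3) #2) #1) #0) (≐-sym (∧E₁ hyp2) ∙ hyp1))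
    (cut (≐E Φ-hole (≐-sym (∧E₁ hyp)) (Φ-reindex refl refl refl refl hyp1))
    (∃SE (∀E hyp8 #3)
      (cut {a = eqS (vs (vs vz)) vz} (⊃E (⊃E (∀SE (∧E₂ (∧E₂ hyp)) (vs (vs vz))) ⊤I) (Φ-reindex refl refl refl refl (∧E₁ (∧E₂ hyp5))))
      (cut {a = eqS (vs vz) vz} (⊃E (⊃E (∀SE (∧E₂ (∧E₂ hyp1)) (vs vz)) ⊤I) (Φ-reindex refl refl refl refl hyp2))
        (≐E (#0 ∈' vs vz) (∧E₂ hyp4) (⇔E₂ (∀E hyp #2) (⇔E₁ (∀E hyp1 #2) (∧E₂ (∧E₂ hyp7))))))))))))))))))
    where
    Φ-hole : Form ⊤ (suc (suc (suc (suc (suc (suc n)))))) (tt ∷ tt ∷ G)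
    Φ-hole = sub (λ { zero → #0 ; (suc i) → var (suc (suc (suc (suc (suc (suc i)))))) }) (λ { vz → vz ; (vs y) → vs (vs y) }) Φ

  graph-is-Δ¹₁ : ε ▷ unique-choice ⊩ ∀N (∀S tt in-graph∀ ⇔ ∃S tt in-graph∃)
  graph-is-Δ¹₁ = ∀I (⇔I graph∀⇒graph∃ graph∃⇒graph∀)

  -- m ∈ X_n puts a code of (n,m) in the graph via U = X_n; conversely, injectivity of codes and uniqueness
  -- of X_n turn b ∈ U back into m ∈ X_n.
  graph-is-choice-function :
    mapC wkS (ε ▷ unique-choice) ▷ ∀N (#0 ∈' vz ⇔ ∃S tt (sub var skip1 in-graph∃))
      ⊩ ⊤' ∧' ∀N (∃S tt (⊤' ∧' (sub var skip1 Φ ∧' ∀N (#0 ∈' vz ⇔ pairMem #1 #0 (vs vz)))))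
  graph-is-choice-function = ∧I ⊤I (∀I (∃SE (∀E hyp1 #0) (∃SI vz (∧I ⊤I (∧I (Φ-reindex refl refl refl refl (∧E₁ (∧E₂ hyp)))
    (∀I (⇔I
      (∃E (∀E (∀E (closed twicePair-even) #1) #0) (∃I #0 (∧I hyp
         (⇔E₂ (∀E hyp3 #0) (∃SI vz (∃I #2 (∃I #1 (∧I hyp (∧I (Φ-reindex refl refl refl refl (∧E₁ (∧E₂ hyp2))) hyp1)))))))))
      (∃E hyp (∃SE (⇔E₁ (∀E hyp3 #0) (∧E₂ hyp)) (∃E hyp (∃E hyp
        (cut (⊃E (∀E (∀E (∀E (∀E (closed twicePair-injective) #4) #3) #1) #0) (≐-sym (∧E₁ hyp3) ∙ ∧E₁ hyp))
        (cut (≐E Φ-hole (≐-sym (∧E₁ hyp)) (Φ-reindex refl refl refl refl (∧E₁ (∧E₂ hyp1))))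
          (≐E (#0 ∈' vs vz) (≐-sym (∧E₂ hyp1))
            (⇔E₁ (∀E (⊃E (⊃E (∀SE (∧E₂ (∧E₂ hyp7)) vz) ⊤I) (Φ-reindex refl refl refl refl hyp)) #0)
              (∧E₂ (∧E₂ hyp2)))))))))))))))))
    where
    Φ-hole : Form ⊤ (suc (suc (suc (suc (suc (suc n)))))) (tt ∷ tt ∷ tt ∷ G)
    Φ-hole = sub (λ { zero → #0 ; (suc i) → var (suc (suc (suc (suc (suc (suc i)))))) }) (λ { vz → vz ; (vs y) → vs (vs (vs y)) }) Φ

  unique-choice⇒choice-function : ε ▷ unique-choice ⊩ choice-function
  unique-choice⇒choice-function =
    ∃S-map (⊃E (lift (ax (inj₂ (d11c in-graph∀ in-graph∃ in-graph∀-QF in-graph∃-QF)))) graph-is-Δ¹₁)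
      graph-is-choice-function
    where
    in-graph∃-QF : QF in-graph∃
    in-graph∃-QF = s∃N (s∃N (s∧ s≐ (s∧ (Simple-sub Φ-QF) (s∈ tt))))
    in-graph∀-QF : QF in-graph∀
    in-graph∀-QF = s∧ (s∃N (s∃N s≐)) (s∀N (s∀N (s⊃ s≐ (s⊃ (Simple-sub Φ-QF) (s∈ tt)))))

-- Soundness

sound-axiom : ∀ {n} {Γ : List ℕ} {φ : Form ℕ n Γ} → SA-ax φ → ArΔ ⊢ tr collapse φ
sound-axiom (basic pa1) = ax (inj₁ (basic pa1))
sound-axiom (basic pa2) = ax (inj₁ (basic pa2))
sound-axiom (basic pa3) = ax (inj₁ (basic pa3))
sound-axiom (basic pa4) = ax (inj₁ (basic pa4))
sound-axiom (basic pa5) = ax (inj₁ (basic pa5))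
sound-axiom (basic pa6) = ax (inj₁ (basic pa6))
sound-axiom (basic (induction φ)) =
  subst₂ (λ base step → ArΔ ⊢ base ⊃ ∀N (tr collapse φ ⊃ step) ⊃ ∀N (tr collapse φ))
    (sym (tr-inst collapse 𝟎 φ)) (sym (tr-sub collapse _ (λ x → x) (λ x → x) (λ _ → refl) φ))
    (ax (inj₁ (basic (induction (tr collapse φ)))))
sound-axiom (comp k φ s) rewrite tr-wkS collapse {k = k} φ =
  un {H = ε} (∃S-map (lift (ax (inj₁ (comp (tr collapse φ) (tr-Simple collapse (λ _ → s∈ tt) s))))) (∧I ⊤I hyp))
sound-axiom (choice k φ s) rewrite tr-skip1 collapse {l = k} φ | tr-skip1 collapse {l = suc k} φ =
  un (⊃I (Choice.unique-choice⇒choice-function (tr collapse φ) (tr-Simple collapse (λ _ → s∈ tt) s)))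

sound : ∀ {n} {Γ : List ℕ} {φ : Form ℕ n Γ} → SA ⊢ φ → ArΔ ⊢ tr collapse φ
sound (ax a) = sound-axiom a
sound (mp p q) = mp (sound p) (sound q)
sound pK = pK
sound pS = pS
sound ∧i = ∧i
sound ∧e₁ = ∧e₁
sound ∧e₂ = ∧e₂
sound ∨i₁ = ∨i₁
sound ∨i₂ = ∨i₂
sound ∨e = ∨e
sound ⊥e = ⊥e
sound dne = dne
sound (∀N-inst {φ = φ} t) rewrite tr-inst collapse t φ = ∀N-inst t
sound (∀N-gen {ψ = ψ} p) = ∀N-gen (subst (λ χ → ArΔ ⊢ χ ⊃ _) (tr-wkN collapse ψ) (sound p))
sound (∃N-intro {φ = φ} t) rewrite tr-inst collapse t φ = ∃N-intro t
sound (∃N-elim {ψ = ψ} p) = ∃N-elim (subst (λ χ → ArΔ ⊢ _ ⊃ χ) (tr-wkN collapse ψ) (sound p))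
sound (∀S-inst {φ = φ} y) rewrite tr-instS collapse y φ = un {H = ε} (⊃I (⊃E (∀SE hyp (trV y)) ⊤I))
sound (∀S-gen {ψ = ψ} p) =
  ∀S-gen (un {H = ε} (⊃I (⊃I (⊃E (lift (subst (λ χ → ArΔ ⊢ χ ⊃ _) (tr-wkS collapse ψ) (sound p))) hyp1))))
sound (∃S-intro {φ = φ} y) rewrite tr-instS collapse y φ = un {H = ε} (⊃I (∃SI (trV y) (∧I ⊤I hyp)))
sound (∃S-elim {ψ = ψ} p) =
  ∃S-elim (un {H = ε} (⊃I (⊃E (lift (subst (λ χ → ArΔ ⊢ _ ⊃ χ) (tr-wkS collapse ψ) (sound p))) (∧E₂ hyp))))
sound (S-strengthen {φ = φ} p) = S-strengthen (subst (ArΔ ⊢_) (tr-wkS collapse φ) (sound p))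
sound ≐-refl = ≐-refl
sound (≐-subst {t = t} {u} {φ}) rewrite tr-inst collapse t φ | tr-inst collapse u φ = ≐-subst

generalize-closeN : ∀ n {Γ : List ℕ} (φ : Form ℕ n Γ) → ArΔ ⊢ tr collapse φ → ArΔ ⊢ tr collapse (closeN φ)
generalize-closeN zero φ p = p
generalize-closeN (suc n) φ p = generalize-closeN n (∀N φ) (un (∀I {H = ε} ⟨ p ⟩))

generalize-closeS : ∀ (Γ : List ℕ) (φ : Form ℕ 0 Γ) → ArΔ ⊢ tr collapse φ → ArΔ ⊢ tr collapse (closeS φ)
generalize-closeS [] φ p = p
generalize-closeS (k ∷ Γ) φ p = generalize-closeS Γ (∀S k φ) (un (∀SI {H = ε} (⊃I (lift p))))

corollary1 : Σ Interp (λ I → ∀ {n} {Γ : List ℕ} (φ : Form ℕ n Γ) → SA ⊢ φ → ArΔ ⊢ tr I (closure φ))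
corollary1 = collapse , λ {n} {Γ} φ p → generalize-closeS Γ (closeN φ) (generalize-closeN n φ (sound p))
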